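{- Given a finite set of atomic propositions $AP$ and an operator precedence matrix $M$ on $2^{AP}$, let $\varphi$ be an $\mathcal X_{until}$ formula, $T\in\mathcal T_M$ an OPM-compatible tree, $s$ a node of $T$, and $w_T$ the OP word obtained from $T$ by $\tau^{ -1}$. Then $(T,s)\models\varphi$ if and only if $(w_T,\tau^{ -1}(s))\models\iota_{\mathcal X}(\varphi)$.
   Context: Let $AP$ be partitioned into normal propositions and structural labels, $\#\notin AP$ an end marker, $\Sigma=2^{AP}$. An operator precedence matrix (OPM) $M$ on $\Sigma$ is a partial function $M:(\Sigma\cup\{\#\})^2\to\{\lessdot,\doteq,\gtrdot\}$, defined only on sets containing exactly one structural label, depending only on structural labels. Write $a\,\pi\,b$ for $M(a,b)=\pi$; by convention $\#\lessdot b$ for every $b$ (including $\#$) and $a\gtrdot\#$ for $a\in\Sigma$. A simple chain is $c_0c_1\dots c_\ell c_{\ell+1}$, $\ell\ge1$, $c_0,c_{\ell+1}\in\Sigma\cup\{\#\}$, $c_1..c_\ell\in\Sigma$, $c_0\lessdot c_1\doteq\dots\doteq c_\ell\gtrdot c_{\ell+1}$; a composed chain is $c_0s_0c_1\dots c_\ell s_\ell c_{\ell+1}$ with $c_0c_1\dots c_{\ell+1}$ simple and each $s_k$ empty or with $c_ks_kc_{k+1}$ a chain. $x\in\Sigma^*$ is compatible with $M$ if $M$ is defined on consecutive letters and on the context of every chain substring of $\#x\#$. An OP word is $w=\langle U,M,P\rangle$, $U=\{0,\dots,n+1\}$, $P(0)=P(n+1)=\#$, $P(1)\cdots P(n)$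 compatible with $M$; $i\,\pi\,j$ means $P(i)\,\pi\,P(j)$; $\chi(i,j)$ iff $i<j-1$ and $P(i)\cdots P(j)$ is a chain. POTL over $AP$: $\varphi::=a\mid\neg\varphi\mid\varphi\lor\varphi\mid\bigcirc^{\Pi}\varphi\mid\ominus^{\Pi}\varphi\mid\chi_F^{\Pi}\varphi\mid\chi_P^{\Pi}\varphi\mid\varphi\,\mathcal U_\chi^{\Pi}\,\varphi\mid\varphi\,\mathcal S_\chi^{\Pi}\,\varphi\mid\bigcirc_H^{\mu}\varphi\mid\ominus_H^{\mu}\varphi\mid\varphi\,\mathcal U_H^{\mu}\,\varphi\mid\varphi\,\mathcal S_H^{\mu}\,\varphi$, $\Pi\subseteq\{\lessdot,\doteq,\gtrdot\}$ nonempty, $\mu\in\{\lessdot,\gtrdot\}$. Semantics at $i$: $a$ iff $a\in P(i)$; Booleans usual. $\bigcirc^\Pi\varphi$: $i\,\pi\,(i+1)$, $\pi\in\Pi$, $\varphi$ at $i+1$. $\ominus^\Pi\varphi$: $(i-1)\,\pi\,i$, $\pi\in\Pi$, $\varphi$ at $i-1$. $\chi_F^\Pi\varphi$: some $j>i$, $\chi(i,j)$, $i\,\pi\,j$ ($\pi\in\Pi$), $\varphi$ at $j$. $\chi_P^\Pi\varphi$: some $j<i$, $\chi(j,i)$, $j\,\pi\,i$ ($\pi\in\Pi$), $\varphi$ at $j$. $\bigcirc_H^\lessdot\varphi$: some $h<i$ has $\chi(h,i)$, $h\lessdot i$, $\{k>i:\chi(h,k),h\lessdot k\}\neq\emptyset$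 and $\varphi$ at its minimum; $\ominus_H^\lessdot\varphi$: same with $\{k<i:\chi(h,k),h\lessdot k\}$, maximum. $\bigcirc_H^\gtrdot\varphi$: some $h>i$ has $\chi(i,h)$, $i\gtrdot h$, $\{k>i:\chi(k,h),k\gtrdot h\}\ne\emptyset$, $\varphi$ at its minimum; $\ominus_H^\gtrdot$: $\{k<i:\chi(k,h),k\gtrdot h\}$, maximum. A path from $i$ to $j$ is $i=i_1<\dots<i_n=j$. For a path set $\Gamma$: $\varphi\,\mathcal U_\Gamma\,\psi$ at $i$ iff for some $j\ge i$ a $\Gamma$-path from $i$ to $j$ has $\varphi$ at $i_1..i_{n-1}$, $\psi$ at $i_n$; $\varphi\,\mathcal S_\Gamma\,\psi$ at $i$ iff for some $j\le i$ a $\Gamma$-path $j=i_1<\dots<i_n=i$ has $\psi$ at $i_1$, $\varphi$ at $i_2..i_n$. Summary path for $\Pi$: for each $p<n$, if $K_p=\{h\le j:\chi(i_p,h),i_p\,\pi\,h,\pi\in\Pi\}\ne\emptyset$ then $i_{p+1}=\max K_p$, else $i_{p+1}=i_p+1$ with $i_p\,\pi\,(i_p+1)$, $\pi\in\Pi$ ($\mathcal U_\chi^\Pi,\mathcal S_\chi^\Pi$). Yield-precedence hierarchical path: some $h<i$ has $\chi(h,i_p)$, $h\lessdot i_p$ for all $p$, and no $k$ with $i_q<k<i_{q+1}$, $\chi(h,k)$ ($\mathcal U_H^\lessdot,\mathcal S_H^\lessdot$). Take-precedence hierarchical path: some $h>j$ has $\chi(i_p,h)$, $i_p\gtrdot h$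 for all $p$, no $k$ with $i_q<k<i_{q+1}$, $\chi(k,h)$ ($\mathcal U_H^\gtrdot,\mathcal S_H^\gtrdot$). Unranked ordered trees: nodes are finite sequences of naturals (prefix-closed; $s\cdot k$ with $k>0$ present implies $s\cdot(k-1)$ present); $s\,R_\Downarrow\,t$ iff $t=s\cdot k$; $s\,R_\Rightarrow\,t$ iff $s=r\cdot h,t=r\cdot(h+1)$; $R_\Uparrow,R_\Leftarrow$ are the converses; labels $L(s)\in\Sigma\cup\{\#\}$; write $s\,\pi\,s'$ for $L(s)\,\pi\,L(s')$. The right context candidate $\mathrm{Rcc}(s)$: the immediate right sibling of $s$ if it exists, otherwise $\mathrm{Rcc}$ of the parent of $s$ (undefined at the root). $\mathcal T_M$ is the set of trees $T$ such that: the root is labeled $\#$ and has at most two children, the rightmost labeled $\#$; no other node is labeled $\#$; for every node $s$ with children, its rightmost child $r$ satisfies $s\lessdot r$ or $s\doteq r$, and every other child $s'$ satisfies $s\lessdot s'$; and if $s$ has no child $s'$ with $s\doteq s'$, then $s\gtrdot\mathrm{Rcc}(s)$ whenever $\mathrm{Rcc}(s)$ exists. For $T\in\mathcal T_M$, $w_T$ is the OP word whose sequence of labels $P(0),P(1),\dots$ is the sequence of labels of the nodes of $T$ in preorder (a node, then the subtrees of its children from left to right), and $\tau^{ -1}(s)$ is the index of node $s$ in this preorder (root $=0$); $w_T$ is an OP word for $M$. $\mathcal X_{until}$: $\varphi::=p\mid\top\mid\neg\varphi\mid\varphi\land\varphi\mid\rho(\varphi,\varphi)$, $p\in AP$, $\rho\in\{\Downarrow,\Uparrow,\Rightarrow,\Leftarrow\}$.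 $(T,s)\models p$ iff $p\in L(s)$; $(T,s)\models\rho(\varphi,\psi)$ iff there is $t$ with $s\,R_\rho^+\,t$, $(T,t)\models\psi$, and $(T,r)\models\varphi$ for all $r$ with $s\,R_\rho^+\,r$ and $r\,R_\rho^+\,t$ ($R^+$ the transitive closure). $\iota_{\mathcal X}$ is the identity on propositional operators and, writing $\varphi'=\iota_{\mathcal X}(\varphi)$, $\psi'=\iota_{\mathcal X}(\psi)$: $\iota_{\mathcal X}(\Downarrow(\varphi,\psi))=\bigcirc^{\lessdot\doteq}(\varphi'\,\mathcal U_\chi^{\lessdot\doteq}\,\psi')\lor\chi_F^{\lessdot\doteq}(\varphi'\,\mathcal U_\chi^{\lessdot\doteq}\,\psi')$; $\iota_{\mathcal X}(\Uparrow(\varphi,\psi))=\ominus^{\lessdot\doteq}(\varphi'\,\mathcal S_\chi^{\lessdot\doteq}\,\psi')\lor\chi_P^{\lessdot\doteq}(\varphi'\,\mathcal S_\chi^{\lessdot\doteq}\,\psi')$; $\iota_{\mathcal X}(\Rightarrow(\varphi,\psi))=\bigcirc_H^\lessdot(\varphi'\,\mathcal U_H^\lessdot\,\psi')\lor\big(\neg\bigcirc_H^\lessdot(\top\,\mathcal U_H^\lessdot\,\neg\varphi')\land\chi_P^\lessdot(\chi_F^\doteq\psi')\big)\lor\ominus^\lessdot\big(\chi_F^\lessdot(\psi'\land\neg\ominus_H^\lessdot(\top\,\mathcal S_H^\lessdot\,\neg\varphi'))\big)\lor\ominus^\lessdot(\chi_F^\doteq\psi'\land\neg\chi_F^\lessdot\neg\varphi')$;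 $\iota_{\mathcal X}(\Leftarrow(\varphi,\psi))=\ominus_H^\lessdot(\varphi'\,\mathcal S_H^\lessdot\,\psi')\lor\chi_P^\doteq\big(\chi_F^\lessdot(\neg\bigcirc_H^\lessdot\top\land\varphi'\,\mathcal S_H^\lessdot\,\psi')\big)\lor\big(\chi_P^\lessdot(\bigcirc^\lessdot\psi')\land\neg\ominus_H^\lessdot(\top\,\mathcal S_H^\lessdot\,\neg\varphi')\big)\lor\chi_P^\doteq(\bigcirc^\lessdot\psi'\land\neg\chi_F^\lessdot\neg\varphi')$. -}

module Defs where

open import Data.Nat using (ℕ; zero; suc; _+_; _<_; _≤_)
open import Data.Fin using (Fin)
open import Data.Fin.Subset using (Subset; _∈_)
open import Data.Bool using (Bool; true; false)
open import Data.Vec using (Vec; lookup)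
open import Data.List using (List; []; _∷_; _++_; [_]; length)
open import Data.List.NonEmpty using (List⁺; _∷_; toList)
open import Data.List.Relation.Unary.All using (All)
open import Data.List.Relation.Unary.Any using (Any)
open import Data.Maybe using (Maybe; just; nothing; maybe)
open import Data.Product using (Σ; ∃; ∃₂; _×_; _,_)
open import Data.Sum using (_⊎_)
open import Data.Empty using (⊥)
open import Data.Unit using () renaming (⊤ to Unit)
open import Relation.Nullary using (¬_)
open import Relation.Binary.PropositionalEquality using (_≡_; _≢_)
open import Relation.Binary.Construct.Closure.Transitive using (TransClosure)

-- AP = Fin n (a finite set); isS i ≡ true means that i is a structural
-- label, otherwise a normal proposition.  Σ = 2^AP = Subset n.

data Label (n : ℕ) : Set where
  ♯   : Label n
  sym : Subset n → Label n

_∈L_ : ∀ {n} → Fin n → Label n → Set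
p ∈L ♯     = ⊥
p ∈L sym a = p ∈ a

data Prec : Set where
  ⋖ ≐ ⋗ : Prec

OneStruct : ∀ {n} → (Fin n → Bool) → Subset n → Set
OneStruct {n} isS a =
  Σ (Fin n) λ i → isS i ≡ true × i ∈ a ×
    (∀ j → isS j ≡ true → j ∈ a → j ≡ i)

SameStruct : ∀ {n} → (Fin n → Bool) → Subset n → Subset n → Set
SameStruct isS a b = ∀ i → isS i ≡ true → lookup a i ≡ lookup b i

-- An operator precedence matrix on Σ (its values on # are fixed by
-- the conventions, see `prec` below).
record OPM (n : ℕ) (isS : Fin n → Bool) : Set where
  field
    mat        : Subset n → Subset n → Maybe Prec
    onlyOneStr : ∀ a b π → mat a b ≡ just π → OneStruct isS a × OneStruct isS b
    onlyStr    : ∀ a a′ b b′ → SameStruct isS a a′ → SameStruct isS b b′ →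
                 mat a b ≡ mat a′ b′

prec : ∀ {n isS} → OPM n isS → Label n → Label n → Maybe Prec
prec M ♯       _       = just ⋖
prec M (sym a) ♯       = just ⋗
prec M (sym a) (sym b) = OPM.mat M a b

_∈Π_ : Prec → List⁺ Prec → Set
π ∈Π Π = Any (π ≡_) (toList Π)

data HDir : Set where
  hY hT : HDir   -- hY = ⋖ (yield), hT = ⋗ (take)

infixr 4 _∨ₚ_
infixr 5 _∧ₚ_
data POTL (n : ℕ) : Set where
  atom      : Fin n → POTL n
  ⊤ₚ        : POTL n
  ¬ₚ_       : POTL n → POTL n
  _∨ₚ_ _∧ₚ_ : POTL n → POTL n → POTL n
  ○ ⊖ χF χP : List⁺ Prec → POTL n → POTL n
  Uχ Sχ     : List⁺ Prec → POTL n → POTL n → POTL n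
  ○H ⊖H     : HDir → POTL n → POTL n
  UH SH     : HDir → POTL n → POTL n → POTL n

-- words: the list of labels P(0) P(1) ... P(n+1)
Word : ℕ → Set
Word n = List (Label n)

at : ∀ {n} → Word n → ℕ → Label n
at []       _       = ♯
at (x ∷ _)  zero    = x
at (_ ∷ xs) (suc i) = at xs i

-- path i = i₁ < i₂ < … given as its start and list of further points
lastOf : ℕ → List ℕ → ℕ
lastOf i []       = i
lastOf i (y ∷ ys) = lastOf y ys

data Consec (R : ℕ → ℕ → Set) : ℕ → List ℕ → Set where
  []  : ∀ {x} → Consec R x []
  _∷_ : ∀ {x y ys} → R x y → Consec R y ys → Consec R x (y ∷ ys)

UAlong : (ℕ → Set) → (ℕ → Set) → ℕ → List ℕ → Set
UAlong Φ Ψ i []       = Ψ i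
UAlong Φ Ψ i (y ∷ ys) = Φ i × UAlong Φ Ψ y ys

module WordSem {n : ℕ} {isS : Fin n → Bool} (M : OPM n isS) (w : Word n) where

  P : ℕ → Label n
  P = at w

  InU : ℕ → Set
  InU k = k < length w

  _≺[_]_ : ℕ → Prec → ℕ → Set
  i ≺[ π ] j = prec M (P i) (P j) ≡ just π

  PrecIn : List⁺ Prec → ℕ → ℕ → Set
  PrecIn Π i j = ∃ λ π → π ∈Π Π × i ≺[ π ] j

  NotEnd : ℕ → Set
  NotEnd c = P c ≢ ♯

  -- (composed) chains  c₀ s₀ c₁ … c_ℓ s_ℓ c_{ℓ+1}
  data Chain : ℕ → ℕ → Set
  -- c_k s_k c_{k+1}: s_k empty, or c_k s_k c_{k+1} is a chain
  data Seg : ℕ → ℕ → Set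
  -- c₁ ≐ c₂ ≐ … ≐ c_ℓ  (with the segments in between), all in Σ
  data Run : ℕ → ℕ → Set

  data Chain where
    chain : ∀ {i c₁ cℓ j} → i ≺[ ⋖ ] c₁ → Seg i c₁ → Run c₁ cℓ →
            cℓ ≺[ ⋗ ] j → Seg cℓ j → Chain i j

  data Seg where
    adj  : ∀ {i} → Seg i (suc i)
    nest : ∀ {i j} → Chain i j → Seg i j

  data Run where
    one  : ∀ {c} → NotEnd c → Run c c
    more : ∀ {c c′ cℓ} → NotEnd c → c ≺[ ≐ ] c′ → Seg c c′ → Run c′ cℓ → Run c cℓ

  χ : ℕ → ℕ → Set
  χ i j = suc i < j × InU j × Chain i j

  InK : List⁺ Prec → ℕ → ℕ → ℕ → Set
  InK Π j ip h = h ≤ j × χ ip h × PrecIn Π ip h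

  SumStep : List⁺ Prec → ℕ → ℕ → ℕ → Set
  SumStep Π j a b =
      (InK Π j a b × (∀ h → InK Π j a h → h ≤ b))
    ⊎ ((∀ h → ¬ InK Π j a h) × b ≡ suc a × InU b × PrecIn Π a b)

  SumPath : List⁺ Prec → ℕ → List ℕ → Set
  SumPath Π i ys = Consec (SumStep Π (lastOf i ys)) i ys

  YPath : ℕ → List ℕ → Set
  YPath i ys = ∃ λ h → h < i × All (λ p → χ h p × h ≺[ ⋖ ] p) (i ∷ ys) ×
    Consec (λ a b → a < b × (∀ k → a < k → k < b → ¬ χ h k)) i ys

  TPath : ℕ → List ℕ → Set
  TPath i ys = ∃ λ h → lastOf i ys < h × All (λ p → χ p h × p ≺[ ⋗ ] h) (i ∷ ys) ×
    Consec (λ a b → a < b × (∀ k → a < k → k < b → ¬ χ k h)) i ys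

  HPath : HDir → ℕ → List ℕ → Set
  HPath hY = YPath
  HPath hT = TPath

  UntilG : (ℕ → List ℕ → Set) → (ℕ → Set) → (ℕ → Set) → ℕ → Set
  UntilG Γ Φ Ψ i = ∃ λ ys → Γ i ys × UAlong Φ Ψ i ys

  SinceG : (ℕ → List ℕ → Set) → (ℕ → Set) → (ℕ → Set) → ℕ → Set
  SinceG Γ Φ Ψ i = ∃ λ j → ∃ λ ys → lastOf j ys ≡ i × Γ j ys × Ψ j × All Φ ys

  Sat : POTL n → ℕ → Set
  Sat (atom p)  i = p ∈L P i
  Sat ⊤ₚ        i = Unit
  Sat (¬ₚ φ)    i = ¬ Sat φ i
  Sat (φ ∨ₚ ψ)  i = Sat φ i ⊎ Sat ψ i
  Sat (φ ∧ₚ ψ)  i = Sat φ i × Sat ψ i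
  Sat (○ Π φ)   i = InU (suc i) × PrecIn Π i (suc i) × Sat φ (suc i)
  Sat (⊖ Π φ)   i = ∃ λ i′ → i ≡ suc i′ × PrecIn Π i′ i × Sat φ i′
  Sat (χF Π φ)  i = ∃ λ j → i < j × χ i j × PrecIn Π i j × Sat φ j
  Sat (χP Π φ)  i = ∃ λ j → j < i × χ j i × PrecIn Π j i × Sat φ j
  Sat (Uχ Π φ ψ) i = UntilG (SumPath Π) (λ k → Sat φ k) (λ k → Sat ψ k) i
  Sat (Sχ Π φ ψ) i = SinceG (SumPath Π) (λ k → Sat φ k) (λ k → Sat ψ k) i
  Sat (○H hY φ) i = ∃ λ h → h < i × χ h i × h ≺[ ⋖ ] i ×
    ∃ λ k → i < k × χ h k × h ≺[ ⋖ ] k ×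
      (∀ k′ → i < k′ → k′ < k → ¬ (χ h k′ × h ≺[ ⋖ ] k′)) × Sat φ k
  Sat (⊖H hY φ) i = ∃ λ h → h < i × χ h i × h ≺[ ⋖ ] i ×
    ∃ λ k → k < i × χ h k × h ≺[ ⋖ ] k ×
      (∀ k′ → k < k′ → k′ < i → ¬ (χ h k′ × h ≺[ ⋖ ] k′)) × Sat φ k
  Sat (○H hT φ) i = ∃ λ h → i < h × χ i h × i ≺[ ⋗ ] h ×
    ∃ λ k → i < k × χ k h × k ≺[ ⋗ ] h ×
      (∀ k′ → i < k′ → k′ < k → ¬ (χ k′ h × k′ ≺[ ⋗ ] h)) × Sat φ k
  Sat (⊖H hT φ) i = ∃ λ h → i < h × χ i h × i ≺[ ⋗ ] h ×
    ∃ λ k → k < i × χ k h × k ≺[ ⋗ ] h ×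
      (∀ k′ → k < k′ → k′ < i → ¬ (χ k′ h × k′ ≺[ ⋗ ] h)) × Sat φ k
  Sat (UH μ φ ψ) i = UntilG (HPath μ) (λ k → Sat φ k) (λ k → Sat ψ k) i
  Sat (SH μ φ ψ) i = SinceG (HPath μ) (λ k → Sat φ k) (λ k → Sat ψ k) i

-- Unranked ordered trees (nodes = addresses, sequences of naturals)

data Tree (n : ℕ) : Set where
  node : Label n → List (Tree n) → Tree n

rootLabel : ∀ {n} → Tree n → Label n
rootLabel (node a _) = a

mutual
  sub : ∀ {n} → Tree n → List ℕ → Maybe (Tree n)
  sub t          []      = just t
  sub (node a ts) (k ∷ s) = subL ts k s

  subL : ∀ {n} → List (Tree n) → ℕ → List ℕ → Maybe (Tree n)
  subL []       k       s = nothing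
  subL (t ∷ ts) zero    s = sub t s
  subL (t ∷ ts) (suc k) s = subL ts k s

IsNode : ∀ {n} → Tree n → List ℕ → Set
IsNode T s = ∃ λ t → sub T s ≡ just t

-- L(s)  (only meaningful for nodes s of T)
lab : ∀ {n} → Tree n → List ℕ → Label n
lab T s = maybe rootLabel ♯ (sub T s)

R⇓ : ∀ {n} → Tree n → List ℕ → List ℕ → Set
R⇓ T s t = IsNode T s × IsNode T t × ∃ λ k → t ≡ s ++ [ k ]

R⇒ : ∀ {n} → Tree n → List ℕ → List ℕ → Set
R⇒ T s t = IsNode T s × IsNode T t × ∃₂ λ r h → s ≡ r ++ [ h ] × t ≡ r ++ [ suc h ]

mutual
  preorder : ∀ {n} → Tree n → List (Label n)
  preorder (node a ts) = a ∷ preorderL ts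

  preorderL : ∀ {n} → List (Tree n) → List (Label n)
  preorderL []       = []
  preorderL (t ∷ ts) = preorder t ++ preorderL ts

mutual
  size : ∀ {n} → Tree n → ℕ
  size (node a ts) = suc (sizeL ts)

  sizeL : ∀ {n} → List (Tree n) → ℕ
  sizeL []       = 0
  sizeL (t ∷ ts) = size t + sizeL ts

mutual
  τ⁻¹ : ∀ {n} → Tree n → List ℕ → ℕ
  τ⁻¹ t           []      = 0
  τ⁻¹ (node a ts) (k ∷ s) = suc (τ⁻¹L ts k s)

  τ⁻¹L : ∀ {n} → List (Tree n) → ℕ → List ℕ → ℕ
  τ⁻¹L []       k       s = 0
  τ⁻¹L (t ∷ ts) zero    s = τ⁻¹ t s
  τ⁻¹L (t ∷ ts) (suc k) s = size t + τ⁻¹L ts k s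

wordOf : ∀ {n} → Tree n → Word n
wordOf = preorder

data Rcc {n : ℕ} (T : Tree n) : List ℕ → List ℕ → Set where
  sib : ∀ {s t} r h → s ≡ r ++ [ h ] → t ≡ r ++ [ suc h ] → IsNode T t → Rcc T s t
  up  : ∀ {s t} r h → s ≡ r ++ [ h ] → ¬ IsNode T (r ++ [ suc h ]) → Rcc T r t → Rcc T s t

NPrec : ∀ {n isS} → OPM n isS → Tree n → List ℕ → Prec → List ℕ → Set
NPrec M T s π t = prec M (lab T s) (lab T t) ≡ just π

record InTM {n : ℕ} {isS : Fin n → Bool} (M : OPM n isS) (T : Tree n) : Set where
  field
    -- root labelled #, with children  [#]  or  [x, #]  (the final # is the end marker)
    rootShape : ∃ λ ts → T ≡ node ♯ ts ×
                  (ts ≡ [ node ♯ [] ] ⊎ ∃ λ x → ts ≡ x ∷ [ node ♯ [] ])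
    hashOnly  : ∀ s → IsNode T s → lab T s ≡ ♯ →
                  s ≡ [] ⊎ ∃ λ k → s ≡ [ k ] × ¬ IsNode T [ suc k ]
    rightmost : ∀ s k → IsNode T (s ++ [ k ]) → ¬ IsNode T (s ++ [ suc k ]) →
                  NPrec M T s ⋖ (s ++ [ k ]) ⊎ NPrec M T s ≐ (s ++ [ k ])
    others    : ∀ s k → IsNode T (s ++ [ k ]) → IsNode T (s ++ [ suc k ]) →
                  NPrec M T s ⋖ (s ++ [ k ])
    rcc       : ∀ s → IsNode T s →
                  (¬ ∃ λ k → IsNode T (s ++ [ k ]) × NPrec M T s ≐ (s ++ [ k ])) →
                  ∀ t → Rcc T s t → NPrec M T s ⋗ t

data Dir : Set where
  D⇓ D⇑ D⇒ D⇐ : Dir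

R : ∀ {n} → Dir → Tree n → List ℕ → List ℕ → Set
R D⇓ T s t = R⇓ T s t
R D⇑ T s t = R⇓ T t s
R D⇒ T s t = R⇒ T s t
R D⇐ T s t = R⇒ T t s

data XU (n : ℕ) : Set where
  prop  : Fin n → XU n
  ⊤ₓ    : XU n
  ¬ₓ_   : XU n → XU n
  _∧ₓ_  : XU n → XU n → XU n
  until : Dir → XU n → XU n → XU n

XSat : ∀ {n} → Tree n → XU n → List ℕ → Set
XSat T (prop p)  s = p ∈L lab T s
XSat T ⊤ₓ        s = Unit
XSat T (¬ₓ φ)    s = ¬ XSat T φ s
XSat T (φ ∧ₓ ψ)  s = XSat T φ s × XSat T ψ s
XSat T (until ρ φ ψ) s = ∃ λ t → TransClosure (R ρ T) s t × XSat T ψ t ×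
  (∀ r → TransClosure (R ρ T) s r → TransClosure (R ρ T) r t → XSat T φ r)

Π⋖≐ Π⋖ Π≐ : List⁺ Prec
Π⋖≐ = ⋖ ∷ (≐ ∷ [])
Π⋖  = ⋖ ∷ []
Π≐  = ≐ ∷ []

ι : ∀ {n} → XU n → POTL n
ι (prop p)  = atom p
ι ⊤ₓ        = ⊤ₚ
ι (¬ₓ φ)    = ¬ₚ ι φ
ι (φ ∧ₓ ψ)  = ι φ ∧ₚ ι ψ
ι (until D⇓ φ ψ) =
  ○ Π⋖≐ (Uχ Π⋖≐ (ι φ) (ι ψ)) ∨ₚ χF Π⋖≐ (Uχ Π⋖≐ (ι φ) (ι ψ))
ι (until D⇑ φ ψ) =
  ⊖ Π⋖≐ (Sχ Π⋖≐ (ι φ) (ι ψ)) ∨ₚ χP Π⋖≐ (Sχ Π⋖≐ (ι φ) (ι ψ))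
ι (until D⇒ φ ψ) =
     ○H hY (UH hY (ι φ) (ι ψ))
  ∨ₚ ((¬ₚ ○H hY (UH hY ⊤ₚ (¬ₚ ι φ))) ∧ₚ χP Π⋖ (χF Π≐ (ι ψ)))
  ∨ₚ ⊖ Π⋖ (χF Π⋖ (ι ψ ∧ₚ ¬ₚ ⊖H hY (SH hY ⊤ₚ (¬ₚ ι φ))))
  ∨ₚ ⊖ Π⋖ (χF Π≐ (ι ψ) ∧ₚ ¬ₚ χF Π⋖ (¬ₚ ι φ))
ι (until D⇐ φ ψ) =
     ⊖H hY (SH hY (ι φ) (ι ψ))
  ∨ₚ χP Π≐ (χF Π⋖ ((¬ₚ ○H hY ⊤ₚ) ∧ₚ SH hY (ι φ) (ι ψ)))
  ∨ₚ (χP Π⋖ (○ Π⋖ (ι ψ)) ∧ₚ ¬ₚ ⊖H hY (SH hY ⊤ₚ (¬ₚ ι φ)))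
  ∨ₚ χP Π≐ (○ Π⋖ (ι ψ) ∧ₚ ¬ₚ χF Π⋖ (¬ₚ ι φ))

module Submission where

-- Write pos s = τ⁻¹(s); the subtree at s
-- occupies [pos s, pos s + sz s) in w_T, and pos is a bijection from the nodes of T onto
-- the positions of w_T (PreorderIndex, NodePositions).  The heart is a description of
-- the chains of w_T for T ∈ 𝒯_M (TreeChains): a chain from s goes either to a non-first
-- child of s, or, if s has children but no ≐-child, over its whole subtree to Rcc(s);
-- moreover s ⋖ s·k for every non-last child and s ⋖ or ≐ its last child.  Hence each
-- POTL operator of ι is a tree move (TreeModalities): ○ and χ_F over {⋖,≐} go to children,
-- ⊖ and χ_P to the parent, summary paths are downward paths, ○_H^⋖, ⊖_H^⋖ and
-- hierarchical ⋖-paths move along ⋖-siblings.  On the tree side (TransitiveUntil,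
-- TreeUntil) ρ(φ,ψ) unfolds step by step along R_ρ, and XSat is decidable, which turns
-- the negated existentials in ι(⇒(φ,ψ)), ι(⇐(φ,ψ)) into universal statements.
-- Translation combines these by induction on φ, one direction ρ at a time.

open import Defs hiding (sym)
open import Data.Bool using (Bool)
open import Data.Empty using (⊥; ⊥-elim)
open import Data.Fin using (Fin)
open import Data.Fin.Subset.Properties using (_∈?_)
open import Data.List using (List; []; _∷_; _++_; [_]; length; initLast; _∷ʳ′_)
open import Data.List.NonEmpty using (List⁺; _∷_)
open import Data.List.Properties using (length-++; ++-assoc; ++-identityʳ; ∷ʳ-injective; ++-cancelˡ)
open import Data.List.Relation.Unary.All using (All; []; _∷_)
open import Data.List.Relation.Unary.Any using (here; there)
open import Data.Maybe using (Maybe; just; nothing; maybe)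
open import Data.Nat
open import Data.Nat.Properties
open import Data.Product
open import Data.Sum using (_⊎_; inj₁; inj₂)
open import Data.Unit using (tt)
open import Function.Base using (_∘_)
open import Function.Bundles using (_⇔_; mk⇔; Equivalence)
open import Relation.Binary.Construct.Closure.Transitive using (TransClosure; _∷_) renaming ([_] to ⟪_⟫)
open import Relation.Binary.PropositionalEquality
  using (_≡_; _≢_; refl; sym; trans; cong; cong₂; subst; module ≡-Reasoning)
open import Relation.Nullary
open import Relation.Nullary.Decidable using (_×-dec_; _⊎-dec_; ¬?; map′)

module PreorderIndex where

  mutual
    length-preorder : ∀ {n} (t : Tree n) → length (preorder t) ≡ size t
    length-preorder (node a ts) = cong suc (length-preorderL ts)

    length-preorderL : ∀ {n} (ts : List (Tree n)) → length (preorderL ts) ≡ sizeL ts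
    length-preorderL []       = refl
    length-preorderL (t ∷ ts) =
      trans (length-++ (preorder t)) (cong₂ _+_ (length-preorder t) (length-preorderL ts))

  mutual
    sub-++ : ∀ {n} (t : Tree n) u v {t'} → sub t u ≡ just t' → sub t (u ++ v) ≡ sub t' v
    sub-++ t           []      v refl = refl
    sub-++ (node a ts) (k ∷ u) v e    = subL-++ ts k u v e

    subL-++ : ∀ {n} (ts : List (Tree n)) k u v {t'} → subL ts k u ≡ just t' → subL ts k (u ++ v) ≡ sub t' v
    subL-++ []       k       u v ()
    subL-++ (t ∷ ts) zero    u v e = sub-++ t u v e
    subL-++ (t ∷ ts) (suc k) u v e = subL-++ ts k u v e

  mutual
    τ⁻¹-++ : ∀ {n} (t : Tree n) u v {t'} → sub t u ≡ just t' → τ⁻¹ t (u ++ v) ≡ τ⁻¹ t u + τ⁻¹ t' v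
    τ⁻¹-++ t           []      v refl = refl
    τ⁻¹-++ (node a ts) (k ∷ u) v e    = cong suc (τ⁻¹L-++ ts k u v e)

    τ⁻¹L-++ : ∀ {n} (ts : List (Tree n)) k u v {t'} → subL ts k u ≡ just t' →
              τ⁻¹L ts k (u ++ v) ≡ τ⁻¹L ts k u + τ⁻¹ t' v
    τ⁻¹L-++ []       k       u v ()
    τ⁻¹L-++ (t ∷ ts) zero    u v e = τ⁻¹-++ t u v e
    τ⁻¹L-++ (t ∷ ts) (suc k) u v e =
      trans (cong (size t +_) (τ⁻¹L-++ ts k u v e)) (sym (+-assoc (size t) _ _))

  mutual
    preorder-factor : ∀ {n} (t : Tree n) u {t'} → sub t u ≡ just t' →
      Σ (List (Label n)) λ pre → Σ (List (Label n)) λ suf →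
        preorder t ≡ pre ++ preorder t' ++ suf × length pre ≡ τ⁻¹ t u
    preorder-factor t [] refl = [] , [] , sym (++-identityʳ _) , refl
    preorder-factor (node a ts) (k ∷ u) e with preorderL-factor ts k u e
    ... | pre , suf , eq , len = a ∷ pre , suf , cong (a ∷_) eq , cong suc len

    preorderL-factor : ∀ {n} (ts : List (Tree n)) k u {t'} → subL ts k u ≡ just t' →
      Σ (List (Label n)) λ pre → Σ (List (Label n)) λ suf →
        preorderL ts ≡ pre ++ preorder t' ++ suf × length pre ≡ τ⁻¹L ts k u
    preorderL-factor [] k u ()
    preorderL-factor (t ∷ ts) zero u {t'} e with preorder-factor t u e
    ... | pre , suf , eq , len =
      pre , suf ++ preorderL ts ,
      trans (cong (_++ preorderL ts) eq)
        (trans (++-assoc pre _ _) (cong (pre ++_) (++-assoc (preorder t') suf (preorderL ts)))) ,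
      len
    preorderL-factor (t ∷ ts) (suc k) u e with preorderL-factor ts k u e
    ... | pre , suf , eq , len =
      preorder t ++ pre , suf ,
      trans (cong (preorder t ++_) eq) (sym (++-assoc (preorder t) pre _)) ,
      trans (length-++ (preorder t)) (cong₂ _+_ (length-preorder t) len)

  []≢snoc : ∀ (r : List ℕ) k → [] ≢ r ++ [ k ]
  []≢snoc []      k ()
  []≢snoc (x ∷ r) k ()

  snoc-injective : ∀ {r r' : List ℕ} {h h'} → r ++ [ h ] ≡ r' ++ [ h' ] → r ≡ r' × h ≡ h'
  snoc-injective {r} {r'} = ∷ʳ-injective r r'

  length-snoc : ∀ (r : List ℕ) h → length (r ++ [ h ]) ≡ suc (length r)
  length-snoc r h = trans (length-++ r) (+-comm (length r) 1)

  at-++ʳ : ∀ {n} (xs ys : List (Label n)) k → at (xs ++ ys) (length xs + k) ≡ at ys k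
  at-++ʳ []       ys k = refl
  at-++ʳ (x ∷ xs) ys k = at-++ʳ xs ys k

  at-++ˡ : ∀ {n} (xs ys : List (Label n)) k → k < length xs → at (xs ++ ys) k ≡ at xs k
  at-++ˡ (x ∷ xs) ys zero    _       = refl
  at-++ˡ (x ∷ xs) ys (suc k) (s≤s p) = at-++ˡ xs ys k p

  at-subtree : ∀ {n} (t : Tree n) u {t'} → sub t u ≡ just t' → ∀ k → k < size t' →
               at (preorder t) (τ⁻¹ t u + k) ≡ at (preorder t') k
  at-subtree t u {t'} e k k< with preorder-factor t u e
  ... | pre , suf , eq , len rewrite eq | sym len =
    trans (at-++ʳ pre (preorder t' ++ suf) k)
          (at-++ˡ (preorder t') suf k (subst (k <_) (sym (length-preorder t')) k<))

  size≥1 : ∀ {n} (t : Tree n) → 1 ≤ size t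
  size≥1 (node a ts) = s≤s z≤n

  mutual
    τ⁻¹+size≤ : ∀ {n} (t : Tree n) u {t'} → sub t u ≡ just t' → τ⁻¹ t u + size t' ≤ size t
    τ⁻¹+size≤ t           []      refl = ≤-refl
    τ⁻¹+size≤ (node a ts) (k ∷ u) e    = s≤s (τ⁻¹L+size≤ ts k u e)

    τ⁻¹L+size≤ : ∀ {n} (ts : List (Tree n)) k u {t'} → subL ts k u ≡ just t' →
                 τ⁻¹L ts k u + size t' ≤ sizeL ts
    τ⁻¹L+size≤ []       k       u ()
    τ⁻¹L+size≤ (t ∷ ts) zero    u e = ≤-trans (τ⁻¹+size≤ t u e) (m≤m+n _ _)
    τ⁻¹L+size≤ (t ∷ ts) (suc k) u e =
      subst (_≤ size t + sizeL ts) (sym (+-assoc (size t) _ _)) (+-monoʳ-≤ (size t) (τ⁻¹L+size≤ ts k u e))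

  τ⁻¹<size : ∀ {n} (t : Tree n) u {t'} → sub t u ≡ just t' → τ⁻¹ t u < size t
  τ⁻¹<size t u {t'} e = <-≤-trans (m<m+n (τ⁻¹ t u) (size≥1 t')) (τ⁻¹+size≤ t u e)

  mutual
    τ⁻¹-surjective : ∀ {n} (t : Tree n) k → k < size t → Σ (List ℕ) λ u → IsNode t u × τ⁻¹ t u ≡ k
    τ⁻¹-surjective t zero p = [] , (t , refl) , refl
    τ⁻¹-surjective (node a ts) (suc k) (s≤s p) with τ⁻¹L-surjective ts k p
    ... | i , u , nd , e = i ∷ u , nd , cong suc e

    τ⁻¹L-surjective : ∀ {n} (ts : List (Tree n)) k → k < sizeL ts →
      Σ ℕ λ i → Σ (List ℕ) λ u → (∃ λ t' → subL ts i u ≡ just t') × τ⁻¹L ts i u ≡ k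
    τ⁻¹L-surjective [] k ()
    τ⁻¹L-surjective (t ∷ ts) k p with k <? size t
    ... | yes q with τ⁻¹-surjective t k q
    ...   | u , nd , e = zero , u , nd , e
    τ⁻¹L-surjective (t ∷ ts) k p | no q
      with τ⁻¹L-surjective ts (k ∸ size t)
             (+-cancelˡ-< (size t) _ _ (subst (_< size t + sizeL ts) (sym (m+[n∸m]≡n (≮⇒≥ q))) p))
    ...   | i , u , nd , e = suc i , u , nd , trans (cong (size t +_) e) (m+[n∸m]≡n (≮⇒≥ q))

  mutual
    τ⁻¹-injective : ∀ {n} (t : Tree n) u v {a b} → sub t u ≡ just a → sub t v ≡ just b →
                    τ⁻¹ t u ≡ τ⁻¹ t v → u ≡ v
    τ⁻¹-injective t           []      []       e₁ e₂ q = refl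
    τ⁻¹-injective (node x ts) []      (k ∷ v)  e₁ e₂ ()
    τ⁻¹-injective (node x ts) (k ∷ u) []       e₁ e₂ ()
    τ⁻¹-injective (node x ts) (k ∷ u) (k' ∷ v) e₁ e₂ q with τ⁻¹L-injective ts k u k' v e₁ e₂ (suc-injective q)
    ... | refl , refl = refl

    τ⁻¹L-injective : ∀ {n} (ts : List (Tree n)) i u j v {a b} → subL ts i u ≡ just a → subL ts j v ≡ just b →
                     τ⁻¹L ts i u ≡ τ⁻¹L ts j v → i ≡ j × u ≡ v
    τ⁻¹L-injective []       i       u j       v () e₂ q
    τ⁻¹L-injective (t ∷ ts) zero    u zero    v e₁ e₂ q = refl , τ⁻¹-injective t u v e₁ e₂ q
    τ⁻¹L-injective (t ∷ ts) zero    u (suc j) v e₁ e₂ q =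
      ⊥-elim (<⇒≱ (τ⁻¹<size t u e₁) (subst (size t ≤_) (sym q) (m≤m+n _ _)))
    τ⁻¹L-injective (t ∷ ts) (suc i) u zero    v e₁ e₂ q =
      ⊥-elim (<⇒≱ (τ⁻¹<size t v e₂) (subst (size t ≤_) q (m≤m+n _ _)))
    τ⁻¹L-injective (t ∷ ts) (suc i) u (suc j) v e₁ e₂ q
      with τ⁻¹L-injective ts i u j v e₁ e₂ (+-cancelˡ-≡ (size t) _ _ q)
    ... | refl , refl = refl , refl

  τ⁻¹L-first : ∀ {n} (ts : List (Tree n)) → τ⁻¹L ts 0 [] ≡ 0
  τ⁻¹L-first []       = refl
  τ⁻¹L-first (t ∷ ts) = refl

  τ⁻¹L-next : ∀ {n} (ts : List (Tree n)) k {t} → subL ts k [] ≡ just t →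
              τ⁻¹L ts (suc k) [] ≡ τ⁻¹L ts k [] + size t
  τ⁻¹L-next []       k ()
  τ⁻¹L-next (t ∷ ts) zero    refl = trans (cong (size t +_) (τ⁻¹L-first ts)) (+-comm (size t) 0)
  τ⁻¹L-next (t ∷ ts) (suc k) e    = trans (cong (size t +_) (τ⁻¹L-next ts k e)) (sym (+-assoc (size t) _ _))

  τ⁻¹L-last : ∀ {n} (ts : List (Tree n)) k {t} → subL ts k [] ≡ just t → subL ts (suc k) [] ≡ nothing →
              τ⁻¹L ts k [] + size t ≡ sizeL ts
  τ⁻¹L-last []                k       ()   _
  τ⁻¹L-last (t ∷ [])          zero    refl _  = +-comm 0 (size t)
  τ⁻¹L-last (t ∷ (t' ∷ ts))   zero    refl ()
  τ⁻¹L-last (t ∷ ts)          (suc k) e₁   e₂ =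
    trans (+-assoc (size t) _ _) (cong (size t +_) (τ⁻¹L-last ts k e₁ e₂))

  subL-previous : ∀ {n} (ts : List (Tree n)) k {t} → subL ts (suc k) [] ≡ just t → ∃ λ t' → subL ts k [] ≡ just t'
  subL-previous []       k ()
  subL-previous (t ∷ ts) zero    e = t , refl
  subL-previous (t ∷ ts) (suc k) e = subL-previous ts k e

  nothing≢just : ∀ {A : Set} {x : A} → nothing ≡ just x → ⊥
  nothing≢just ()

  subL-last : ∀ {n} (ts : List (Tree n)) k {t} → subL ts k [] ≡ just t →
              Σ ℕ λ m → (∃ λ t' → subL ts m [] ≡ just t') × subL ts (suc m) [] ≡ nothing
  subL-last []                k ()
  subL-last (t ∷ [])          k e = 0 , (t , refl) , refl
  subL-last (t ∷ (t' ∷ ts))   k e with subL-last (t' ∷ ts) 0 refl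
  ... | m , p , q = suc m , p , q

  mutual
    sub-prefix : ∀ {n} (t : Tree n) u v {b} → sub t (u ++ v) ≡ just b → ∃ λ a → sub t u ≡ just a
    sub-prefix t           []      v e = t , refl
    sub-prefix (node x ts) (k ∷ u) v e = subL-prefix ts k u v e

    subL-prefix : ∀ {n} (ts : List (Tree n)) k u v {b} → subL ts k (u ++ v) ≡ just b → ∃ λ a → subL ts k u ≡ just a
    subL-prefix []       k       u v ()
    subL-prefix (t ∷ ts) zero    u v e = sub-prefix t u v e
    subL-prefix (t ∷ ts) (suc k) u v e = subL-prefix ts k u v e

  subL-bound : ∀ {n} (ts : List (Tree n)) k {t} → subL ts k [] ≡ just t → k < length ts
  subL-bound []       k ()
  subL-bound (x ∷ ts) zero    e = s≤s z≤n
  subL-bound (x ∷ ts) (suc k) e = s≤s (subL-bound ts k e)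

  subL-exists : ∀ {n} (ts : List (Tree n)) k → k < length ts → ∃ λ t → subL ts k [] ≡ just t
  subL-exists (x ∷ ts) zero    p       = x , refl
  subL-exists (x ∷ ts) (suc k) (s≤s p) = subL-exists ts k p

open PreorderIndex

module TransitiveUntil {A : Set} (R : A → A → Set) where

  TCUntil : (Φ Ψ : A → Set) → A → Set
  TCUntil Φ Ψ s = ∃ λ t → TransClosure R s t × Ψ t × (∀ r → TransClosure R s r → TransClosure R r t → Φ r)

  data Unfold (Φ Ψ : A → Set) : A → Set where
    now   : ∀ {s y} → R s y → Ψ y → Unfold Φ Ψ s
    later : ∀ {s y} → R s y → Φ y → Unfold Φ Ψ y → Unfold Φ Ψ s

  TCUntil⇒Unfold : ∀ {Φ Ψ s} → TCUntil Φ Ψ s → Unfold Φ Ψ s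
  TCUntil⇒Unfold {Φ} {Ψ} (t , c , p , f) = go c f
    where
    go : ∀ {s} → TransClosure R s t → (∀ r → TransClosure R s r → TransClosure R r t → Φ r) → Unfold Φ Ψ s
    go ⟪ r ⟫   f = now r p
    go (r ∷ c) f = later r (f _ ⟪ r ⟫ c) (go c λ r' c₁ c₂ → f r' (r ∷ c₁) c₂)

  NoDetour : Set
  NoDetour = ∀ {s y r} → R s y → TransClosure R s r → TransClosure R r y → ⊥

  ThroughSuccessor : Set
  ThroughSuccessor = ∀ {s y t r} → R s y → TransClosure R y t → TransClosure R s r → TransClosure R r t →
                     r ≡ y ⊎ TransClosure R y r

  Unfold⇒TCUntil : NoDetour → ThroughSuccessor → ∀ {Φ Ψ s} → Unfold Φ Ψ s → TCUntil Φ Ψ s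
  Unfold⇒TCUntil no-detour through (now r p) = _ , ⟪ r ⟫ , p , λ r' c₁ c₂ → ⊥-elim (no-detour r c₁ c₂)
  Unfold⇒TCUntil no-detour through {Φ} (later r f u) with Unfold⇒TCUntil no-detour through u
  ... | t , c , p , fs = t , r ∷ c , p , between
    where
    between : ∀ r' → TransClosure R _ r' → TransClosure R r' t → Φ r'
    between r' c₁ c₂ with through r c c₁ c₂
    ... | inj₁ refl = f
    ... | inj₂ c₃   = fs r' c₃ c₂

  rank-increases : (f : A → ℕ) → (∀ {x y} → R x y → f y ≡ suc (f x)) →
                   ∀ {x y} → TransClosure R x y → f x < f y
  rank-increases f step ⟪ r ⟫   = ≤-reflexive (sym (step r))
  rank-increases f step (r ∷ c) = <-trans (≤-reflexive (sym (step r))) (rank-increases f step c)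

  rank-decreases : (f : A → ℕ) → (∀ {x y} → R x y → f x ≡ suc (f y)) →
                   ∀ {x y} → TransClosure R x y → f y < f x
  rank-decreases f step ⟪ r ⟫   = ≤-reflexive (sym (step r))
  rank-decreases f step (r ∷ c) = <-trans (rank-decreases f step c) (≤-reflexive (sym (step r)))

  no-detour-rank-inc : (f : A → ℕ) → (∀ {x y} → R x y → f y ≡ suc (f x)) → NoDetour
  no-detour-rank-inc f step {r = r'} r c₁ c₂ =
    <-irrefl refl (≤-trans (s≤s (rank-increases f step c₁)) (subst (suc (f r') ≤_) (step r) (rank-increases f step c₂)))

  no-detour-rank-dec : (f : A → ℕ) → (∀ {x y} → R x y → f x ≡ suc (f y)) → NoDetour
  no-detour-rank-dec f step {r = r'} r c₁ c₂ =
    <-irrefl refl (≤-trans (s≤s (rank-decreases f step c₂)) (subst (suc (f r') ≤_) (step r) (rank-decreases f step c₁)))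

  through-functional : (∀ {x y y'} → R x y → R x y' → y ≡ y') → ThroughSuccessor
  through-functional functional r _ ⟪ r' ⟫   _ = inj₁ (functional r' r)
  through-functional functional r _ (r' ∷ c) _ with functional r' r
  ... | refl = inj₂ c

open TransitiveUntil

-- Quantifiers bounded by m over a predicate decidable below m (the library's
-- anyUpTo? and allUpTo? need a predicate decidable everywhere).
module BoundedSearch (m : ℕ) (P : ℕ → Set) (P? : ∀ k → k < m → Dec (P k)) where

  bounded-∃? : Dec (∃ λ k → k < m × P k)
  bounded-∃? = map′ (λ (k , k<m , _ , p) → k , k<m , p) (λ (k , k<m , p) → k , k<m , k<m , p) (anyUpTo? below? m)
    where
    below? : ∀ k → Dec (k < m × P k)
    below? k with k <? m
    ... | yes k<m = map′ (k<m ,_) proj₂ (P? k k<m)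
    ... | no k≮m  = no (k≮m ∘ proj₁)

  bounded-∀? : Dec (∀ k → k < m → P k)
  bounded-∀? = map′ (λ all k k<m → all k<m k<m) (λ all {k} k<m _ → all k k<m) (allUpTo? below? m)
    where
    below? : ∀ k → Dec (k < m → P k)
    below? k with k <? m
    ... | yes k<m = map′ (λ p _ → p) (λ f → f k<m) (P? k k<m)
    ... | no k≮m  = yes (⊥-elim ∘ k≮m)

open BoundedSearch

module NodePositions {n : ℕ} (T : Tree n) where
  open ≡-Reasoning

  N : ℕ
  N = size T

  pos : List ℕ → ℕ
  pos = τ⁻¹ T

  -- Wrapping IsNode in a record lets Agda infer the address from a proof of Node s.
  record Node (s : List ℕ) : Set where
    constructor isNode
    field unNode : IsNode T s
  open Node public

  -- Size of the subtree at s (0 if s is not a node).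
  sz : List ℕ → ℕ
  sz s = maybe size 0 (sub T s)

  node? : ∀ s → Dec (Node s)
  node? s with sub T s in q
  ... | just t  = yes (isNode (t , q))
  ... | nothing = no λ { (isNode (t , e)) → nothing≢just (trans (sym q) e) }

  sz-≡ : ∀ s {t} → sub T s ≡ just t → sz s ≡ size t
  sz-≡ s e rewrite e = refl

  prefix : ∀ s u → Node (s ++ u) → Node s
  prefix s u (isNode (b , e)) = isNode (sub-prefix T s u e)

  pos<N : ∀ {s} → Node s → pos s < N
  pos<N {s} (isNode (t , e)) = τ⁻¹<size T s e

  sz≥1 : ∀ {s} → Node s → 1 ≤ sz s
  sz≥1 {s} (isNode (t , e)) = subst (1 ≤_) (sym (sz-≡ s e)) (size≥1 t)

  sz≰0 : ∀ {s} → Node s → ¬ (sz s ≤ 0)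
  sz≰0 nd le = <-irrefl refl (≤-trans (sz≥1 nd) le)

  label-at-pos : ∀ {s} → Node s → at (preorder T) (pos s) ≡ lab T s
  label-at-pos {s} (isNode (node a ts , e)) rewrite e =
    trans (cong (at (preorder T)) (sym (+-identityʳ (pos s)))) (at-subtree T s e 0 (s≤s z≤n))

  pos-injective : ∀ {s s'} → Node s → Node s' → pos s ≡ pos s' → s ≡ s'
  pos-injective {s} {s'} (isNode (a , e₁)) (isNode (b , e₂)) q = τ⁻¹-injective T s s' e₁ e₂ q

  pos-surjective : ∀ p → p < N → Σ (List ℕ) λ s → Node s × pos s ≡ p
  pos-surjective p q with τ⁻¹-surjective T p q
  ... | s , nd , e = s , isNode nd , e

  node-shape : ∀ s → Node s → Σ (Label n) λ a → Σ (List (Tree n)) λ ts → sub T s ≡ just (node a ts)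
  node-shape s (isNode (node a ts , e)) = a , ts , e

  sub-child : ∀ s k {a ts} → sub T s ≡ just (node a ts) → sub T (s ++ [ k ]) ≡ subL ts k []
  sub-child s k e = sub-++ T s [ k ] e

  child-in-forest : ∀ {s k a ts} → sub T s ≡ just (node a ts) → Node (s ++ [ k ]) →
                    Σ (Tree n) λ tk → subL ts k [] ≡ just tk
  child-in-forest {s} {k} e (isNode (t , q)) = t , trans (sym (sub-child s k e)) q

  no-child-in-forest : ∀ {s k a ts} → sub T s ≡ just (node a ts) → ¬ Node (s ++ [ k ]) → subL ts k [] ≡ nothing
  no-child-in-forest {s} {k} {a} {ts} e nn with subL ts k [] in q
  ... | nothing = refl
  ... | just x  = ⊥-elim (nn (isNode (x , trans (sub-child s k e) q)))

  pos-first-child : ∀ {s} → Node (s ++ [ 0 ]) → pos (s ++ [ 0 ]) ≡ suc (pos s)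
  pos-first-child {s} nd with node-shape s (prefix s [ 0 ] nd)
  ... | a , ts , e =
    trans (τ⁻¹-++ T s [ 0 ] e) (trans (cong (λ z → pos s + suc z) (τ⁻¹L-first ts)) (+-comm (pos s) 1))

  pos-next-sibling : ∀ {s k} → Node (s ++ [ suc k ]) → pos (s ++ [ suc k ]) ≡ pos (s ++ [ k ]) + sz (s ++ [ k ])
  pos-next-sibling {s} {k} nd with node-shape s (prefix s [ suc k ] nd)
  ... | a , ts , e with subL-previous ts k (trans (sym (sub-child s (suc k) e)) (proj₂ (unNode nd)))
  ...   | tk , ek = begin
    pos (s ++ [ suc k ])                     ≡⟨ τ⁻¹-++ T s [ suc k ] e ⟩
    pos s + suc (τ⁻¹L ts (suc k) [])         ≡⟨ cong (λ z → pos s + suc z) (τ⁻¹L-next ts k ek) ⟩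
    pos s + (suc (τ⁻¹L ts k []) + size tk)   ≡⟨ sym (+-assoc (pos s) (suc (τ⁻¹L ts k [])) (size tk)) ⟩
    pos s + suc (τ⁻¹L ts k []) + size tk     ≡⟨ sym (cong₂ _+_ (τ⁻¹-++ T s [ k ] e) sz-k) ⟩
    pos (s ++ [ k ]) + sz (s ++ [ k ])       ∎
    where sz-k = sz-≡ (s ++ [ k ]) (trans (sub-child s k e) ek)

  last-child-end : ∀ {s k} → Node (s ++ [ k ]) → ¬ Node (s ++ [ suc k ]) →
                   pos (s ++ [ k ]) + sz (s ++ [ k ]) ≡ pos s + sz s
  last-child-end {s} {k} nd nn with node-shape s (prefix s [ k ] nd)
  ... | a , ts , e with child-in-forest {s = s} {k = k} e nd
  ...   | tk , ek = begin
    pos (s ++ [ k ]) + sz (s ++ [ k ])       ≡⟨ cong₂ _+_ (τ⁻¹-++ T s [ k ] e) sz-k ⟩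
    pos s + suc (τ⁻¹L ts k []) + size tk     ≡⟨ +-assoc (pos s) (suc (τ⁻¹L ts k [])) (size tk) ⟩
    pos s + suc (τ⁻¹L ts k [] + size tk)     ≡⟨ cong (λ z → pos s + suc z) (τ⁻¹L-last ts k ek no-next) ⟩
    pos s + suc (sizeL ts)                   ≡⟨ cong (pos s +_) (sym (sz-≡ s e)) ⟩
    pos s + sz s                             ∎
    where
    sz-k    = sz-≡ (s ++ [ k ]) (trans (sub-child s k e) ek)
    no-next = no-child-in-forest {s = s} e nn

  leaf-size : ∀ {s} → Node s → ¬ Node (s ++ [ 0 ]) → sz s ≡ 1
  leaf-size {s} nd nn with node-shape s nd
  ... | a , []     , e = sz-≡ s e
  ... | a , t ∷ ts , e = ⊥-elim (nn (isNode (t , trans (sub-child s 0 e) refl)))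

  pos-child-< : ∀ {s k} → Node (s ++ [ k ]) → pos s < pos (s ++ [ k ])
  pos-child-< {s} {k} nd with node-shape s (prefix s [ k ] nd)
  ... | a , ts , e = subst (pos s <_) (sym (τ⁻¹-++ T s [ k ] e)) (m<m+n (pos s) (s≤s z≤n))

  previous-sibling : ∀ {s k} → Node (s ++ [ suc k ]) → Node (s ++ [ k ])
  previous-sibling {s} {k} nd with node-shape s (prefix s [ suc k ] nd)
  ... | a , ts , e with child-in-forest {s = s} {k = suc k} e nd
  ...   | tk , ek with subL-previous ts k ek
  ...     | t' , e' = isNode (t' , trans (sub-child s k e) e')

  earlier-sibling : ∀ {s a b} → Node (s ++ [ b ]) → a ≤ b → Node (s ++ [ a ])
  earlier-sibling {s} {a} {b} nd p with m≤n⇒m<n∨m≡n p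
  ... | inj₂ refl = nd
  earlier-sibling {s} {a} {suc b} nd p | inj₁ (s≤s q) = earlier-sibling (previous-sibling nd) q

  sibling-after : ∀ {s a b} → Node (s ++ [ b ]) → a < b → pos (s ++ [ a ]) + sz (s ++ [ a ]) ≤ pos (s ++ [ b ])
  sibling-after {s} {a} {suc b} nd (s≤s p) with m≤n⇒m<n∨m≡n p
  ... | inj₂ refl = ≤-reflexive (sym (pos-next-sibling nd))
  ... | inj₁ q    = ≤-trans (sibling-after (previous-sibling nd) q)
                      (≤-trans (m≤m+n _ _) (≤-reflexive (sym (pos-next-sibling nd))))

  sibling-< : ∀ {s a b} → Node (s ++ [ b ]) → a < b → pos (s ++ [ a ]) < pos (s ++ [ b ])
  sibling-< {s} {a} nd p = <-≤-trans (m<m+n _ (sz≥1 (earlier-sibling nd (<⇒≤ p)))) (sibling-after nd p)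

  sibling-≤ : ∀ {s a b} → Node (s ++ [ b ]) → a ≤ b → pos (s ++ [ a ]) ≤ pos (s ++ [ b ])
  sibling-≤ nd p with m≤n⇒m<n∨m≡n p
  ... | inj₁ q    = <⇒≤ (sibling-< nd q)
  ... | inj₂ refl = ≤-refl

  sibling-order : ∀ {r a b} → Node (r ++ [ a ]) → Node (r ++ [ b ]) → pos (r ++ [ a ]) < pos (r ++ [ b ]) → a < b
  sibling-order {r} {a} {b} na nb p with a <? b
  ... | yes q = q
  ... | no q  = ⊥-elim (<-irrefl refl (<-≤-trans p (sibling-≤ na (≮⇒≥ q))))

  last-child : ∀ {s k} → Node (s ++ [ k ]) → Σ ℕ λ m → Node (s ++ [ m ]) × ¬ Node (s ++ [ suc m ])
  last-child {s} {k} nd with node-shape s (prefix s [ k ] nd)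
  ... | a , ts , e with child-in-forest {s = s} {k = k} e nd
  ...   | tk , ek with subL-last ts k ek
  ...     | m , (t' , p) , q =
    m , isNode (t' , trans (sub-child s m e) p) ,
    λ { (isNode (x , r)) → nothing≢just (trans (sym (trans (sub-child s (suc m) e) q)) r) }

  ≤-last-child : ∀ {s a b} → Node (s ++ [ a ]) → ¬ Node (s ++ [ suc a ]) → Node (s ++ [ b ]) → b ≤ a
  ≤-last-child {s} {a} {b} n₁ n₂ n₃ with b ≤? a
  ... | yes p = p
  ... | no p  = ⊥-elim (n₂ (earlier-sibling n₃ (≰⇒> p)))

  child-end-≤ : ∀ {s k} → Node (s ++ [ k ]) → pos (s ++ [ k ]) + sz (s ++ [ k ]) ≤ pos s + sz s
  child-end-≤ {s} {k} nd with last-child nd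
  ... | m , ndm , nnm with m≤n⇒m<n∨m≡n (≤-last-child ndm nnm nd)
  ...   | inj₂ refl = ≤-reflexive (last-child-end ndm nnm)
  ...   | inj₁ k<m  = ≤-trans (sibling-after ndm k<m) (≤-trans (m≤m+n _ _) (≤-reflexive (last-child-end ndm nnm)))

  sz-child-< : ∀ {s k} → Node (s ++ [ k ]) → sz (s ++ [ k ]) < sz s
  sz-child-< {s} {k} nd =
    +-cancelˡ-< (pos s) _ _ (<-≤-trans (+-monoˡ-< (sz (s ++ [ k ])) (pos-child-< nd)) (child-end-≤ nd))

  rcc-node : ∀ {s t} → Rcc T s t → Node t
  rcc-node (sib r h _ _ nd) = isNode nd
  rcc-node (up r h _ _ rc)  = rcc-node rc

  rcc-at-end : ∀ {s} → Node s → pos s + sz s < N → Σ (List ℕ) λ t → Rcc T s t × pos t ≡ pos s + sz s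
  rcc-at-end {s} = go (length s) s ≤-refl
    where
    -- by induction on the depth of s: climb while s is a last child
    go : ∀ m s → length s ≤ m → Node s → pos s + sz s < N → Σ (List ℕ) λ t → Rcc T s t × pos t ≡ pos s + sz s
    go m s ls nd lt with initLast s
    ... | [] = ⊥-elim (<-irrefl refl lt)
    go zero    .(r ++ [ h ]) ls nd lt | r ∷ʳ′ h with subst (_≤ 0) (length-snoc r h) ls
    ... | ()
    go (suc m) .(r ++ [ h ]) ls nd lt | r ∷ʳ′ h with node? (r ++ [ suc h ])
    ... | yes nd' = r ++ [ suc h ] , sib r h refl refl (unNode nd') , pos-next-sibling nd'
    ... | no nn with go m r (≤-pred (subst (_≤ suc m) (length-snoc r h) ls)) (prefix r [ h ] nd)
                        (subst (_< N) (last-child-end nd nn) lt)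
    ...   | t , rc , q = t , up r h refl (λ x → nn (isNode x)) rc , trans q (sym (last-child-end nd nn))

  children : ∀ {s} → Node s → Σ ℕ λ m → ∀ k → (Node (s ++ [ k ]) → k < m) × (k < m → Node (s ++ [ k ]))
  children {s} nd with node-shape s nd
  ... | a , ts , e =
    length ts ,
    λ k → (λ ndk → subL-bound ts k (proj₂ (child-in-forest {s = s} {k = k} e ndk))) ,
          (λ p → let (t , q) = subL-exists ts k p in isNode (t , trans (sub-child s k e) q))


module TreeChains {n : ℕ} {isS : Fin n → Bool} (M : OPM n isS) (T : Tree n) (tm : InTM M T) where
  open NodePositions T public
  open WordSem M (preorder T) public

  prec-functional : ∀ {x : Maybe Prec} {π π'} → x ≡ just π → x ≡ just π' → π ≡ π'
  prec-functional refl refl = refl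

  ⋖≢≐ : ⋖ ≢ ≐
  ⋖≢≐ ()

  ⋖≢⋗ : ⋖ ≢ ⋗
  ⋖≢⋗ ()

  ≐≢⋗ : ≐ ≢ ⋗
  ≐≢⋗ ()

  ⋖≐-not-⋗ : ∀ {π} → π ≡ ⋖ ⊎ π ≡ ≐ → π ≢ ⋗
  ⋖≐-not-⋗ (inj₁ refl) ()
  ⋖≐-not-⋗ (inj₂ refl) ()

  PosPrec : List ℕ → Prec → List ℕ → Set
  PosPrec s π t = pos s ≺[ π ] pos t

  node-prec : ∀ {s t π} → Node s → Node t → NPrec M T s π t → PosPrec s π t
  node-prec {s} {t} ns nt e rewrite label-at-pos ns | label-at-pos nt = e

  non-last-child-⋖ : ∀ {s k} → Node (s ++ [ suc k ]) → PosPrec s ⋖ (s ++ [ k ])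
  non-last-child-⋖ {s} {k} nd =
    node-prec (prefix s [ suc k ] nd) (previous-sibling nd)
      (InTM.others tm s k (unNode (previous-sibling nd)) (unNode nd))

  last-child-⋖≐ : ∀ {s k} → Node (s ++ [ k ]) → ¬ Node (s ++ [ suc k ]) →
                  PosPrec s ⋖ (s ++ [ k ]) ⊎ PosPrec s ≐ (s ++ [ k ])
  last-child-⋖≐ {s} {k} nd nn with InTM.rightmost tm s k (unNode nd) (λ x → nn (isNode x))
  ... | inj₁ x = inj₁ (node-prec (prefix s [ k ] nd) nd x)
  ... | inj₂ x = inj₂ (node-prec (prefix s [ k ] nd) nd x)

  child-⋖≐ : ∀ {s k} → Node (s ++ [ k ]) → PosPrec s ⋖ (s ++ [ k ]) ⊎ PosPrec s ≐ (s ++ [ k ])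
  child-⋖≐ {s} {k} nd with node? (s ++ [ suc k ])
  ... | yes q = inj₁ (non-last-child-⋖ q)
  ... | no q  = last-child-⋖≐ nd q

  ≐-child-last : ∀ {s k} → Node (s ++ [ k ]) → PosPrec s ≐ (s ++ [ k ]) → ¬ Node (s ++ [ suc k ])
  ≐-child-last nd e q = ⋖≢≐ (prec-functional (non-last-child-⋖ q) e)

  NoEqChild : List ℕ → Set
  NoEqChild s = ¬ (∃ λ k → Node (s ++ [ k ]) × PosPrec s ≐ (s ++ [ k ]))

  leaf-NoEqChild : ∀ {s} → ¬ Node (s ++ [ 0 ]) → NoEqChild s
  leaf-NoEqChild nn (k , nd , e) = nn (earlier-sibling nd z≤n)

  ⋖-last-NoEqChild : ∀ {s k} → Node (s ++ [ k ]) → ¬ Node (s ++ [ suc k ]) → PosPrec s ⋖ (s ++ [ k ]) → NoEqChild s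
  ⋖-last-NoEqChild ndk nn yields (m , ndm , e)
    with ≤-antisym (≤-last-child ndm (≐-child-last ndm e) ndk) (≤-last-child ndk nn ndm)
  ... | refl = ⋖≢≐ (prec-functional yields e)

  ⋗-subtree-end : ∀ {s} → Node s → NoEqChild s → pos s + sz s < N → pos s ≺[ ⋗ ] (pos s + sz s)
  ⋗-subtree-end {s} nd ne lt with rcc-at-end nd lt
  ... | t , rc , q =
    subst (λ z → pos s ≺[ ⋗ ] z) q
      (node-prec nd (rcc-node rc)
        (InTM.rcc tm s (unNode nd) (λ { (k , x , e) → ne (k , isNode x , node-prec nd (isNode x) e) }) t rc))

  not-end-marker : ∀ {s} → Node s → pos s + sz s < N → NotEnd (pos s)
  not-end-marker {s} nd lt e = <-irrefl (end-marker-pos (trans (sym (label-at-pos nd)) e)) lt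
    where
    end-marker-pos : lab T s ≡ ♯ → pos s + sz s ≡ N
    end-marker-pos e with InTM.hashOnly tm s (unNode nd) e
    ... | inj₁ refl             = refl
    ... | inj₂ (k , refl , nn) = last-child-end {[]} {k} nd (λ x → nn (unNode x))

  mutual
    chain-< : ∀ {i j} → Chain i j → i < j
    chain-< (chain _ sg rn _ sg₂) = <-≤-trans (seg-< sg) (≤-trans (run-≤ rn) (<⇒≤ (seg-< sg₂)))

    seg-< : ∀ {i j} → Seg i j → i < j
    seg-< adj      = ≤-refl
    seg-< (nest c) = chain-< c

    run-≤ : ∀ {i j} → Run i j → i ≤ j
    run-≤ (one _)          = ≤-refl
    run-≤ (more _ _ sg rn) = ≤-trans (<⇒≤ (seg-< sg)) (run-≤ rn)

  ChainShape : ℕ → ℕ → Set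
  ChainShape i j =
      (Σ (List ℕ) λ s → Σ ℕ λ k → Node (s ++ [ suc k ]) × i ≡ pos s × j ≡ pos (s ++ [ suc k ]))
    ⊎ (Σ (List ℕ) λ s → Node s × Node (s ++ [ 0 ]) × NoEqChild s × i ≡ pos s × j ≡ pos s + sz s)

  chain-shape-prec : ∀ {s j π} → Node s → ChainShape (pos s) j → j < N → pos s ≺[ π ] j →
      (Σ ℕ λ k → Node (s ++ [ suc k ]) × j ≡ pos (s ++ [ suc k ]) × (π ≡ ⋖ ⊎ π ≡ ≐))
    ⊎ (π ≡ ⋗ × j ≡ pos s + sz s × NoEqChild s)
  chain-shape-prec {s} {j} {π} nd (inj₁ (s' , k , nd' , e₁ , e₂)) jN r
    with pos-injective (prefix s' [ suc k ] nd') nd (sym e₁)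
  ... | refl with child-⋖≐ nd'
  ...   | inj₁ x = inj₁ (k , nd' , e₂ , inj₁ (prec-functional (subst (λ z → pos s ≺[ π ] z) e₂ r) x))
  ...   | inj₂ x = inj₁ (k , nd' , e₂ , inj₂ (prec-functional (subst (λ z → pos s ≺[ π ] z) e₂ r) x))
  chain-shape-prec {s} {j} {π} nd (inj₂ (s' , nd' , _ , ne , e₁ , e₂)) jN r with pos-injective nd' nd (sym e₁)
  ... | refl =
    inj₂ (prec-functional (subst (λ z → pos s ≺[ π ] z) e₂ r) (⋗-subtree-end nd ne (subst (_< N) e₂ jN)) , e₂ , ne)

  adjacent-first-child : ∀ {s π} → Node s → suc (pos s) < N → pos s ≺[ π ] suc (pos s) → (π ≡ ⋖ ⊎ π ≡ ≐) →
                         Node (s ++ [ 0 ])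
  adjacent-first-child {s} {π} nd lt r le with node? (s ++ [ 0 ])
  ... | yes q = q
  ... | no q  = ⊥-elim (⋖≐-not-⋗ le (prec-functional r (subst (λ z → pos s ≺[ ⋗ ] z) leaf-end
                  (⋗-subtree-end nd (leaf-NoEqChild q) (subst (_< N) (sym leaf-end) lt)))))
    where
    leaf-end : pos s + sz s ≡ suc (pos s)
    leaf-end = trans (cong (pos s +_) (leaf-size nd q)) (+-comm (pos s) 1)

  chain-shape-after-child : ∀ {s k j} → Node s → Node (s ++ [ k ]) → PosPrec s ⋖ (s ++ [ k ]) →
                            j ≡ pos (s ++ [ k ]) + sz (s ++ [ k ]) → ChainShape (pos s) j
  chain-shape-after-child {s} {k} nds ndk yields e with node? (s ++ [ suc k ])
  ... | yes q = inj₁ (s , k , q , refl , trans e (sym (pos-next-sibling q)))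
  ... | no q  = inj₂ (s , nds , earlier-sibling ndk z≤n , ⋖-last-NoEqChild ndk q yields , refl ,
                      trans e (last-child-end ndk q))

  -- The
  -- body c₁ ≐ … ≐ c_ℓ of a chain from s is a run of ≐-children s·k, s·k·k', …,
  -- and the chain closes right after the subtree of its last element.
  mutual
    chain-shape : ∀ {i j} → Chain i j → j < N → ChainShape i j
    chain-shape {i} {j} c@(chain yields sg rn takes sg₂) jN with pos-surjective i (<-trans (chain-< c) jN)
    ... | s , nds , refl with seg-to-child nds sg (≤-<-trans (run-≤ rn) (<-trans (seg-< sg₂) jN)) yields (inj₁ refl)
    ...   | k , ndk , refl with run-of-≐-children rn (<-trans (seg-< sg₂) jN) ndk refl
    ...     | u , ndu , refl , e = chain-shape-after-child nds ndk yields (trans (seg-⋗-to-end ndu sg₂ takes jN) e)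

    seg-to-child : ∀ {s c π} → Node s → Seg (pos s) c → c < N → pos s ≺[ π ] c → (π ≡ ⋖ ⊎ π ≡ ≐) →
                   Σ ℕ λ k → Node (s ++ [ k ]) × c ≡ pos (s ++ [ k ])
    seg-to-child nds adj cN r le =
      0 , adjacent-first-child nds cN r le , sym (pos-first-child (adjacent-first-child nds cN r le))
    seg-to-child nds (nest ch) cN r le with chain-shape-prec nds (chain-shape ch cN) cN r
    ... | inj₁ (k , nd , e , _) = suc k , nd , e
    ... | inj₂ (e , _)          = ⊥-elim (⋖≐-not-⋗ le e)

    seg-⋗-to-end : ∀ {u j} → Node u → Seg (pos u) j → pos u ≺[ ⋗ ] j → j < N → j ≡ pos u + sz u
    seg-⋗-to-end {u} nd adj r jN with node? (u ++ [ 0 ])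
    ... | yes q with child-⋖≐ q
    ...   | inj₁ x = ⊥-elim (⋖≢⋗ (prec-functional (subst (λ z → pos u ≺[ ⋖ ] z) (pos-first-child q) x) r))
    ...   | inj₂ x = ⊥-elim (≐≢⋗ (prec-functional (subst (λ z → pos u ≺[ ≐ ] z) (pos-first-child q) x) r))
    seg-⋗-to-end {u} nd adj r jN | no q = trans (+-comm 1 (pos u)) (cong (pos u +_) (sym (leaf-size nd q)))
    seg-⋗-to-end {u} nd (nest ch) r jN with chain-shape-prec nd (chain-shape ch jN) jN r
    ... | inj₁ (_ , _ , _ , le) = ⊥-elim (⋖≐-not-⋗ le refl)
    ... | inj₂ (_ , e , _)      = e

    -- A run from u descends through ≐-children, which are last children: its
    -- final node's subtree ends where the subtree of u ends.
    run-of-≐-children : ∀ {c d} → Run c d → d < N → ∀ {u} → Node u → c ≡ pos u →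
                        Σ (List ℕ) λ u' → Node u' × d ≡ pos u' × pos u' + sz u' ≡ pos u + sz u
    run-of-≐-children (one _) dN {u} nd refl = u , nd , refl , refl
    run-of-≐-children (more _ r sg rn) dN {u} nd refl with seg-to-child nd sg (≤-<-trans (run-≤ rn) dN) r (inj₂ refl)
    ... | k , ndk , e with run-of-≐-children rn dN ndk e
    ...   | u' , nd' , e' , q =
      u' , nd' , e' , trans q (last-child-end ndk (≐-child-last ndk (subst (λ z → pos u ≺[ ≐ ] z) e r)))

  -- Completeness: chains of the first kind always exist.  Proved together with
  -- chains of the second kind, by induction on the size of the subtree.
  SiblingChains SubtreeChain : List ℕ → Set
  SiblingChains s = ∀ k → Node (s ++ [ suc k ]) → Chain (pos s) (pos (s ++ [ suc k ]))
  SubtreeChain s = Node s → NoEqChild s → Node (s ++ [ 0 ]) → pos s + sz s < N → Chain (pos s) (pos s + sz s)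

  ChainsUpTo : ℕ → Set
  ChainsUpTo f = ∀ s → sz s ≤ f → SiblingChains s × SubtreeChain s

  seg-to-child-from : ∀ s → SiblingChains s → ∀ k → Node (s ++ [ k ]) → Seg (pos s) (pos (s ++ [ k ]))
  seg-to-child-from s chains zero    nd = subst (Seg (pos s)) (sym (pos-first-child nd)) adj
  seg-to-child-from s chains (suc k) nd = nest (chains k nd)

  run-to-subtree-end : ∀ f → ChainsUpTo f → ∀ u → sz u ≤ f → Node u → pos u + sz u < N →
                       Σ ℕ λ c → Run (pos u) c × c ≺[ ⋗ ] (pos u + sz u) × Seg c (pos u + sz u)
  run-to-subtree-end zero st u le nd lt = ⊥-elim (sz≰0 nd le)
  run-to-subtree-end (suc f) st u le nd lt with node? (u ++ [ 0 ])
  ... | no q = pos u , one (not-end-marker nd lt) , ⋗-subtree-end nd (leaf-NoEqChild q) lt ,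
               subst (Seg (pos u)) (trans (+-comm 1 (pos u)) (cong (pos u +_) (sym (leaf-size nd q)))) adj
  ... | yes q with last-child q
  ...   | m , ndm , nnm with last-child-⋖≐ ndm nnm
  ...     | inj₁ x = pos u , one (not-end-marker nd lt) , ⋗-subtree-end nd (⋖-last-NoEqChild ndm nnm x) lt ,
                     nest (proj₂ (st u le) nd (⋖-last-NoEqChild ndm nnm x) q lt)
  ...     | inj₂ x with run-to-subtree-end f (λ s le' → st s (≤-trans le' (n≤1+n f))) (u ++ [ m ])
                          (≤-pred (≤-trans (sz-child-< ndm) le)) ndm (subst (_< N) (sym (last-child-end ndm nnm)) lt)
  ...       | c , rn , takes , sg =
    c , more (not-end-marker nd lt) x (seg-to-child-from u (proj₁ (st u le)) m ndm) rn ,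
    subst (λ z → c ≺[ ⋗ ] z) (last-child-end ndm nnm) takes , subst (Seg c) (last-child-end ndm nnm) sg

  -- A chain from s to s·(k+1): s ⋖ s·k, then the run below s·k closed by ⋗.
  sibling-chains : ∀ f → ChainsUpTo f → ∀ s → sz s ≤ suc f → SiblingChains s
  sibling-chains f st s le k nd
    with run-to-subtree-end f st (s ++ [ k ]) (≤-pred (≤-trans (sz-child-< (previous-sibling nd)) le))
           (previous-sibling nd) (subst (_< N) (pos-next-sibling nd) (pos<N nd))
  ... | c , rn , takes , sg =
    chain (non-last-child-⋖ nd) (seg-to k (previous-sibling nd)) rn
          (subst (λ z → c ≺[ ⋗ ] z) (sym (pos-next-sibling nd)) takes) (subst (Seg c) (sym (pos-next-sibling nd)) sg)
    where
    seg-to : ∀ k' → Node (s ++ [ k' ]) → Seg (pos s) (pos (s ++ [ k' ]))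
    seg-to zero     nd' = subst (Seg (pos s)) (sym (pos-first-child nd')) adj
    seg-to (suc k') nd' = nest (sibling-chains f st s le k' nd')

  -- A chain over the subtree of s: s ⋖ its last child, then the run below it closed by ⋗.
  subtree-chain : ∀ f → ChainsUpTo f → ∀ s → sz s ≤ suc f → SubtreeChain s
  subtree-chain f st s le nds ne nd0 lt with last-child nd0
  ... | m , ndm , nnm with last-child-⋖≐ ndm nnm
  ...   | inj₂ x = ⊥-elim (ne (m , ndm , x))
  ...   | inj₁ x with run-to-subtree-end f st (s ++ [ m ]) (≤-pred (≤-trans (sz-child-< ndm) le)) ndm
                        (subst (_< N) (sym (last-child-end ndm nnm)) lt)
  ...     | c , rn , takes , sg =
    chain x (seg-to-child-from s (sibling-chains f st s le) m ndm) rn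
          (subst (λ z → c ≺[ ⋗ ] z) (last-child-end ndm nnm) takes) (subst (Seg c) (last-child-end ndm nnm) sg)

  chains-all : ∀ f → ChainsUpTo f
  chains-all zero    s le = (λ k nd → ⊥-elim (sz≰0 (prefix s [ suc k ] nd) le)) , λ nd → ⊥-elim (sz≰0 nd le)
  chains-all (suc f) s le = sibling-chains f (chains-all f) s le , subtree-chain f (chains-all f) s le

  sibling-chain : ∀ {s k} → Node (s ++ [ suc k ]) → Chain (pos s) (pos (s ++ [ suc k ]))
  sibling-chain {s} {k} nd = proj₁ (chains-all (sz s) s ≤-refl) k nd

module TreeModalities {n : ℕ} {isS : Fin n → Bool} (M : OPM n isS) (T : Tree n) (tm : InTM M T) where
  open TreeChains M T tm public

  length-word : length (preorder T) ≡ N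
  length-word = length-preorder T

  pos-in-U : ∀ {s} → Node s → InU (pos s)
  pos-in-U {s} nd = subst (pos s <_) (sym length-word) (pos<N nd)

  U-below-N : ∀ {j} → InU j → j < N
  U-below-N {j} = subst (j <_) length-word

  Below≐ : List⁺ Prec → Set
  Below≐ Π = ∀ {π} → π ∈Π Π → π ≡ ⋖ ⊎ π ≡ ≐

  ⋖≐-below : Below≐ Π⋖≐
  ⋖≐-below (here refl)         = inj₁ refl
  ⋖≐-below (there (here refl)) = inj₂ refl
  ⋖≐-below (there (there ()))

  ⋖-below : Below≐ Π⋖
  ⋖-below (here refl) = inj₁ refl
  ⋖-below (there ())

  ≐-below : Below≐ Π≐
  ≐-below (here refl) = inj₂ refl
  ≐-below (there ())

  only-⋖ : ∀ {i j} → PrecIn Π⋖ i j → i ≺[ ⋖ ] j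
  only-⋖ (_ , here refl , x) = x
  only-⋖ (_ , there () , _)

  only-≐ : ∀ {i j} → PrecIn Π≐ i j → i ≺[ ≐ ] j
  only-≐ (_ , here refl , x) = x
  only-≐ (_ , there () , _)

  in-Π⋖ : ∀ {i j} → i ≺[ ⋖ ] j → PrecIn Π⋖ i j
  in-Π⋖ x = ⋖ , here refl , x

  in-Π≐ : ∀ {i j} → i ≺[ ≐ ] j → PrecIn Π≐ i j
  in-Π≐ x = ≐ , here refl , x

  child-prec-⋖≐ : ∀ {u k} → Node (u ++ [ k ]) → PrecIn Π⋖≐ (pos u) (pos (u ++ [ k ]))
  child-prec-⋖≐ nd with child-⋖≐ nd
  ... | inj₁ x = ⋖ , here refl , x
  ... | inj₂ x = ≐ , there (here refl) , x

  ⋖-and-≐ : ∀ {r x} → PosPrec r ⋖ x → PosPrec r ≐ x → ⊥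
  ⋖-and-≐ a b = ⋖≢≐ (prec-functional a b)

  non-last-⋖ : ∀ {r a b} → Node (r ++ [ b ]) → a < b → PosPrec r ⋖ (r ++ [ a ])
  non-last-⋖ nd lt = non-last-child-⋖ (earlier-sibling nd lt)

  before-≐-child : ∀ {r a b} → Node (r ++ [ a ]) → Node (r ++ [ b ]) → PosPrec r ≐ (r ++ [ b ]) →
                   PosPrec r ⋖ (r ++ [ a ]) → a < b
  before-≐-child na nb e l with m≤n⇒m<n∨m≡n (≤-last-child nb (≐-child-last nb e) na)
  ... | inj₁ q    = q
  ... | inj₂ refl = ⊥-elim (⋖-and-≐ l e)

  χ-child : ∀ {s k} → Node (s ++ [ suc k ]) → χ (pos s) (pos (s ++ [ suc k ]))
  χ-child {s} {k} nd =
    <-≤-trans (s≤s (pos-child-< (previous-sibling nd)))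
              (≤-trans (m<m+n _ (sz≥1 (previous-sibling nd))) (≤-reflexive (sym (pos-next-sibling nd)))) ,
    pos-in-U nd , sibling-chain nd

  χ-from-node : ∀ {s j π} → Node s → χ (pos s) j → pos s ≺[ π ] j → π ≡ ⋖ ⊎ π ≡ ≐ →
                Σ ℕ λ k → Node (s ++ [ suc k ]) × j ≡ pos (s ++ [ suc k ])
  χ-from-node nd (_ , jU , ch) r le with chain-shape-prec nd (chain-shape ch (U-below-N jU)) (U-below-N jU) r
  ... | inj₁ (k , nd' , e , _) = k , nd' , e
  ... | inj₂ (e , _)          = ⊥-elim (⋖≐-not-⋗ le e)

  χ-to-node : ∀ {t j π} → Node t → χ j (pos t) → j ≺[ π ] pos t → π ≡ ⋖ ⊎ π ≡ ≐ →
              Σ (List ℕ) λ r → Σ ℕ λ k → t ≡ r ++ [ suc k ] × j ≡ pos r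
  χ-to-node nd (_ , jU , ch) r le with chain-shape ch (U-below-N jU)
  ... | inj₁ (s , k , nd' , e₁ , e₂)          = s , k , pos-injective nd nd' e₂ , e₁
  ... | inj₂ (s , nds , _ , ne , refl , e₂) =
    ⊥-elim (⋖≐-not-⋗ le (prec-functional (subst (λ z → pos s ≺[ _ ] z) e₂ r)
                                         (⋗-subtree-end nds ne (subst (_< N) e₂ (pos<N nd)))))

  χ-from-node-cases : ∀ {r k} → Node r → χ (pos r) k →
                      (Σ ℕ λ m → Node (r ++ [ suc m ]) × k ≡ pos (r ++ [ suc m ])) ⊎ (k ≡ pos r + sz r)
  χ-from-node-cases nd (_ , kU , ch) with chain-shape ch (U-below-N kU)
  ... | inj₁ (s , m , nd' , e₁ , e₂) with pos-injective nd (prefix s [ suc m ] nd') e₁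
  ...   | refl = inj₁ (m , nd' , e₂)
  χ-from-node-cases nd (_ , kU , ch) | inj₂ (s , nds , _ , ne , e₁ , e₂) with pos-injective nd nds e₁
  ...   | refl = inj₂ e₂

  no-χ-between-siblings : ∀ {r a k} → Node (r ++ [ suc a ]) → χ (pos r) k →
                          pos (r ++ [ a ]) < k → k < pos (r ++ [ suc a ]) → ⊥
  no-χ-between-siblings {r} {a} nd c p₁ p₂ with χ-from-node-cases (prefix r [ suc a ] nd) c
  ... | inj₂ e =
    <-irrefl refl (<-≤-trans p₂ (≤-trans (≤-trans (m≤m+n _ _) (child-end-≤ nd)) (≤-reflexive (sym e))))
  ... | inj₁ (m , ndm , e) with suc m ≤? a
  ...   | yes q = <-irrefl refl (<-≤-trans p₁ (subst (_≤ pos (r ++ [ a ])) (sym e) (sibling-≤ (previous-sibling nd) q)))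
  ...   | no q  = <-irrefl refl (<-≤-trans p₂ (subst (pos (r ++ [ suc a ]) ≤_) (sym e) (sibling-≤ ndm (≰⇒> q))))

  ○-first-child : ∀ {Π X s} → Node s → Below≐ Π → Sat (○ Π X) (pos s) →
                  Node (s ++ [ 0 ]) × PrecIn Π (pos s) (pos (s ++ [ 0 ])) × Sat X (pos (s ++ [ 0 ]))
  ○-first-child {Π} {X} {s} nd le (U , (π , m , r) , x) with adjacent-first-child nd (U-below-N U) r (le m)
  ... | nd0 = nd0 , subst (PrecIn Π (pos s)) (sym (pos-first-child nd0)) (π , m , r) ,
              subst (Sat X) (sym (pos-first-child nd0)) x

  first-child-○ : ∀ {Π X s} → Node (s ++ [ 0 ]) → PrecIn Π (pos s) (pos (s ++ [ 0 ])) → Sat X (pos (s ++ [ 0 ])) →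
                  Sat (○ Π X) (pos s)
  first-child-○ {Π} {X} {s} nd p x with pos-first-child nd
  ... | e = subst InU e (pos-in-U nd) , subst (PrecIn Π (pos s)) e p , subst (Sat X) e x

  ⊖-parent-of-first : ∀ {Π X s} → Node s → Below≐ Π → Sat (⊖ Π X) (pos s) →
                      Σ (List ℕ) λ r → s ≡ r ++ [ 0 ] × PrecIn Π (pos r) (pos s) × Sat X (pos r)
  ⊖-parent-of-first {Π} {X} {s} nd le (i , e , (π , m , r) , x)
    with pos-surjective i (<-trans (subst (i <_) (sym e) ≤-refl) (pos<N nd))
  ... | t , ndt , refl with adjacent-first-child ndt (subst (_< N) e (pos<N nd)) (subst (λ z → pos t ≺[ π ] z) e r) (le m)
  ...   | nd0 = t , pos-injective nd nd0 (trans e (sym (pos-first-child nd0))) , (π , m , r) , x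

  parent-of-first-⊖ : ∀ {Π X r} → Node (r ++ [ 0 ]) → PrecIn Π (pos r) (pos (r ++ [ 0 ])) → Sat X (pos r) →
                      Sat (⊖ Π X) (pos (r ++ [ 0 ]))
  parent-of-first-⊖ {r = r} nd p x = pos r , pos-first-child nd , p , x

  χF-later-child : ∀ {Π X s} → Node s → Below≐ Π → Sat (χF Π X) (pos s) →
                   Σ ℕ λ k → Node (s ++ [ suc k ]) × PrecIn Π (pos s) (pos (s ++ [ suc k ])) ×
                             Sat X (pos (s ++ [ suc k ]))
  χF-later-child nd le (j , _ , c , (π , m , r) , x) with χ-from-node nd c r (le m)
  ... | k , ndk , refl = k , ndk , (π , m , r) , x

  later-child-χF : ∀ {Π X s k} → Node (s ++ [ suc k ]) → PrecIn Π (pos s) (pos (s ++ [ suc k ])) →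
                   Sat X (pos (s ++ [ suc k ])) → Sat (χF Π X) (pos s)
  later-child-χF nd p x = _ , <-trans (n<1+n _) (proj₁ (χ-child nd)) , χ-child nd , p , x

  χP-parent-of-later : ∀ {Π X t} → Node t → Below≐ Π → Sat (χP Π X) (pos t) →
                       Σ (List ℕ) λ r → Σ ℕ λ k → t ≡ r ++ [ suc k ] × PrecIn Π (pos r) (pos t) × Sat X (pos r)
  χP-parent-of-later nd le (j , _ , c , (π , m , r) , x) with χ-to-node nd c r (le m)
  ... | r' , k , e , refl = r' , k , e , (π , m , r) , x

  parent-of-later-χP : ∀ {Π X r k} → Node (r ++ [ suc k ]) → PrecIn Π (pos r) (pos (r ++ [ suc k ])) →
                       Sat X (pos r) → Sat (χP Π X) (pos (r ++ [ suc k ]))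
  parent-of-later-χP nd p x = _ , <-trans (n<1+n _) (proj₁ (χ-child nd)) , χ-child nd , p , x

  summary-step-to-child : ∀ {j u b} → Node u → SumStep Π⋖≐ j (pos u) b →
                          Σ ℕ λ k → Node (u ++ [ k ]) × b ≡ pos (u ++ [ k ])
  summary-step-to-child nd (inj₁ ((_ , c , (π , m , r)) , _)) with χ-from-node nd c r (⋖≐-below m)
  ... | k , ndk , e = suc k , ndk , e
  summary-step-to-child nd (inj₂ (_ , refl , U , (π , m , r))) with adjacent-first-child nd (U-below-N U) r (⋖≐-below m)
  ... | nd0 = 0 , nd0 , sym (pos-first-child nd0)

  child-summary-step : ∀ {j u k} → Node (u ++ [ k ]) → pos (u ++ [ k ]) ≤ j → j < pos (u ++ [ k ]) + sz (u ++ [ k ]) →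
                       SumStep Π⋖≐ j (pos u) (pos (u ++ [ k ]))
  child-summary-step {j} {u} {zero} nd l₁ l₂ = inj₂ (no-chain , pos-first-child nd , pos-in-U nd , child-prec-⋖≐ nd)
    where
    no-chain : ∀ h → ¬ InK Π⋖≐ j (pos u) h
    no-chain h (hj , c , (π , m , r)) with χ-from-node (prefix u [ 0 ] nd) c r (⋖≐-below m)
    ... | m' , ndm , refl = <-irrefl refl (<-≤-trans l₂ (≤-trans (sibling-after ndm (s≤s z≤n)) hj))
  child-summary-step {j} {u} {suc k} nd l₁ l₂ = inj₁ ((l₁ , χ-child nd , child-prec-⋖≐ nd) , farthest)
    where
    farthest : ∀ h → InK Π⋖≐ j (pos u) h → h ≤ pos (u ++ [ suc k ])
    farthest h (hj , c , (π , m , r)) with χ-from-node (prefix u [ suc k ] nd) c r (⋖≐-below m)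
    ... | m' , ndm , refl with suc m' ≤? suc k
    ...   | yes q = sibling-≤ nd q
    ...   | no q  = ⊥-elim (<-irrefl refl (<-≤-trans l₂ (≤-trans (sibling-after ndm (≰⇒> q)) hj)))

  summary-step-< : ∀ {Π e a b} → SumStep Π e a b → a < b
  summary-step-< (inj₁ ((_ , (p , _ , _) , _) , _)) = <-trans (n<1+n _) p
  summary-step-< (inj₂ (_ , refl , _))              = n<1+n _

  summary-path-≤ : ∀ {Π e i ys} → Consec (SumStep Π e) i ys → i ≤ lastOf i ys
  summary-path-≤ []        = ≤-refl
  summary-path-≤ (st ∷ cs) = ≤-trans (<⇒≤ (summary-step-< st)) (summary-path-≤ cs)

  ChildStep : ℕ → ℕ → Set
  ChildStep a b = Σ (List ℕ) λ u → Σ ℕ λ k → Node (u ++ [ k ]) × a ≡ pos u × b ≡ pos (u ++ [ k ])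

  child-path-summary : ∀ u ys → Node u → Consec ChildStep (pos u) ys →
                       Consec (SumStep Π⋖≐ (lastOf (pos u) ys)) (pos u) ys ×
                       pos u ≤ lastOf (pos u) ys × lastOf (pos u) ys < pos u + sz u
  child-path-summary u []       nd []                              = [] , ≤-refl , m<m+n _ (sz≥1 nd)
  child-path-summary u (y ∷ ys) nd ((u' , k , nd' , e , refl) ∷ cs) with pos-injective nd (prefix u' [ k ] nd') e
  ... | refl with child-path-summary (u ++ [ k ]) ys nd' cs
  ...   | cs' , l₁ , l₂ =
    child-summary-step nd' l₁ l₂ ∷ cs' , <⇒≤ (<-≤-trans (pos-child-< nd') l₁) , <-≤-trans l₂ (child-end-≤ nd')

  data DownUntil (A B : POTL n) : List ℕ → Set where
    down-here : ∀ {u} → Sat B (pos u) → DownUntil A B u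
    down-step : ∀ {u} k → Sat A (pos u) → Node (u ++ [ k ]) → DownUntil A B (u ++ [ k ]) → DownUntil A B u

  Uχ⇒DownUntil : ∀ {A B u} → Node u → Sat (Uχ Π⋖≐ A B) (pos u) → DownUntil A B u
  Uχ⇒DownUntil {A} {B} {u} nd (ys , cs , along) = go u ys nd cs along
    where
    go : ∀ {j} u ys → Node u → Consec (SumStep Π⋖≐ j) (pos u) ys → UAlong (Sat A) (Sat B) (pos u) ys →
         DownUntil A B u
    go u []       nd []        b          = down-here b
    go u (y ∷ ys) nd (st ∷ cs) (a , along) with summary-step-to-child nd st
    ... | k , ndk , refl = down-step k a ndk (go (u ++ [ k ]) ys ndk cs along)

  DownUntil⇒Uχ : ∀ {A B u} → Node u → DownUntil A B u → Sat (Uχ Π⋖≐ A B) (pos u)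
  DownUntil⇒Uχ {A} {B} {u} nd du with child-path nd du
    where
    child-path : ∀ {u} → Node u → DownUntil A B u →
                 Σ (List ℕ) λ ys → Consec ChildStep (pos u) ys × UAlong (Sat A) (Sat B) (pos u) ys
    child-path nd (down-here b)           = [] , [] , b
    child-path nd (down-step k a ndk du) with child-path ndk du
    ... | ys , cs , along = _ ∷ ys , (_ , k , ndk , refl , refl) ∷ cs , (a , along)
  ... | ys , cs , along = ys , proj₁ (child-path-summary u ys nd cs) , along

  data UpSince (A B : POTL n) : List ℕ → Set where
    up-here : ∀ {p} → Sat B (pos p) → UpSince A B p
    up-step : ∀ {p} r k → p ≡ r ++ [ k ] → Node p → UpSince A B r → Sat A (pos p) → UpSince A B p

  Sχ⇒UpSince : ∀ {A B p} → Node p → Sat (Sχ Π⋖≐ A B) (pos p) → UpSince A B p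
  Sχ⇒UpSince {A} {B} {p} nd (j , ys , e , cs , b , as)
    with pos-surjective j (≤-<-trans (summary-path-≤ cs) (subst (_< N) (sym e) (pos<N nd)))
  ... | u , ndu , refl with go u ys ndu cs (up-here b) as
    where
    go : ∀ {e} u ys → Node u → Consec (SumStep Π⋖≐ e) (pos u) ys → UpSince A B u → All (Sat A) ys →
         Σ (List ℕ) λ v → Node v × pos v ≡ lastOf (pos u) ys × UpSince A B v
    go u []       nd []        us []       = u , nd , refl , us
    go u (y ∷ ys) nd (st ∷ cs) us (a ∷ as) with summary-step-to-child nd st
    ... | k , ndk , refl = go (u ++ [ k ]) ys ndk cs (up-step u k refl ndk us a) as
  ... | v , ndv , e' , us with pos-injective ndv nd (trans e' e)
  ...   | refl = us

  consec-snoc : ∀ {Rel : ℕ → ℕ → Set} {i ys y} → Consec Rel i ys → Rel (lastOf i ys) y →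
                Consec Rel i (ys ++ [ y ])
  consec-snoc []       r = r ∷ []
  consec-snoc (x ∷ cs) r = x ∷ consec-snoc cs r

  lastOf-snoc : ∀ i ys y → lastOf i (ys ++ [ y ]) ≡ y
  lastOf-snoc i []       y = refl
  lastOf-snoc i (x ∷ ys) y = lastOf-snoc x ys y

  all-snoc : ∀ {P : ℕ → Set} {ys y} → All P ys → P y → All P (ys ++ [ y ])
  all-snoc []        py = py ∷ []
  all-snoc (px ∷ as) py = px ∷ all-snoc as py

  UpSince⇒Sχ : ∀ {A B p} → Node p → UpSince A B p → Sat (Sχ Π⋖≐ A B) (pos p)
  UpSince⇒Sχ {A} {B} {p} nd us with child-path nd us
    where
    child-path : ∀ {p} → Node p → UpSince A B p →
                 Σ (List ℕ) λ u → Σ (List ℕ) λ ys → Node u × lastOf (pos u) ys ≡ pos p ×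
                 Consec ChildStep (pos u) ys × Sat B (pos u) × All (Sat A) ys
    child-path {p} nd (up-here b) = p , [] , nd , refl , [] , b , []
    child-path {p} nd (up-step r k refl _ us a) with child-path (prefix r [ k ] nd) us
    ... | u , ys , ndu , e , cs , b , as =
      u , ys ++ [ pos p ] , ndu , lastOf-snoc _ ys _ , consec-snoc cs (r , k , nd , e , refl) , b , all-snoc as a
  ... | u , ys , ndu , e , cs , b , as = pos u , ys , e , proj₁ (child-path-summary u ys ndu cs) , b , as

  -- Hierarchical ⋖-operators live on the non-first children of a common parent r,
  -- which are exactly the positions h ⋖ k with χ(h,k) for h = pos r.
  YieldStep : ℕ → ℕ → ℕ → Set
  YieldStep h a b = a < b × (∀ k → a < k → k < b → ¬ χ h k)

  YieldsTo : ℕ → ℕ → Set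
  YieldsTo h p = χ h p × h ≺[ ⋖ ] p

  next-⋖-sibling : ∀ {r m m'} → Node (r ++ [ suc m' ]) → suc m < suc m' →
                   (∀ k → pos (r ++ [ suc m ]) < k → k < pos (r ++ [ suc m' ]) → ¬ YieldsTo (pos r) k) → m' ≡ suc m
  next-⋖-sibling {r} {m} nd (s≤s lt) none with m≤n⇒m<n∨m≡n lt
  ... | inj₂ refl = refl
  ... | inj₁ lt₂  = ⊥-elim (none (pos (r ++ [ suc (suc m) ])) (sibling-< nd₂ (n<1+n _)) (sibling-< nd (s≤s lt₂))
                                 (χ-child nd₂ , non-last-child-⋖ (earlier-sibling nd (s≤s lt₂))))
    where nd₂ = earlier-sibling nd (<⇒≤ (s≤s lt₂))

  between-siblings : ∀ {r m} → Node (r ++ [ suc (suc m) ]) →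
                     YieldStep (pos r) (pos (r ++ [ suc m ])) (pos (r ++ [ suc (suc m) ]))
  between-siblings nd = sibling-< nd (n<1+n _) , λ k p₁ p₂ c → no-χ-between-siblings nd c p₁ p₂

  ○H-next-sibling : ∀ {X s} → Node s → Sat (○H hY X) (pos s) →
    Σ (List ℕ) λ r → Σ ℕ λ m → s ≡ r ++ [ suc m ] × PosPrec r ⋖ s × Node (r ++ [ suc (suc m) ]) ×
      PosPrec r ⋖ (r ++ [ suc (suc m) ]) × Sat X (pos (r ++ [ suc (suc m) ]))
  ○H-next-sibling nd (h , _ , c , rh , k , ik , ck , rk , none , x) with χ-to-node nd c rh (inj₁ refl)
  ... | r , m , refl , refl with χ-from-node (prefix r [ suc m ] nd) ck rk (inj₁ refl)
  ...   | m' , ndk , refl with next-⋖-sibling ndk (sibling-order nd ndk ik) none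
  ...     | refl = r , m , refl , rh , ndk , rk , x

  next-sibling-○H : ∀ {X r m} → Node (r ++ [ suc (suc m) ]) → PosPrec r ⋖ (r ++ [ suc m ]) →
                    PosPrec r ⋖ (r ++ [ suc (suc m) ]) → Sat X (pos (r ++ [ suc (suc m) ])) →
                    Sat (○H hY X) (pos (r ++ [ suc m ]))
  next-sibling-○H {r = r} {m} nd l₁ l₂ x =
    pos r , pos-child-< (previous-sibling nd) , χ-child (previous-sibling nd) , l₁ ,
    pos (r ++ [ suc (suc m) ]) , sibling-< nd (n<1+n _) , χ-child nd , l₂ ,
    (λ k p₁ p₂ (c , _) → no-χ-between-siblings nd c p₁ p₂) , x

  ⊖H-previous-sibling : ∀ {X s} → Node s → Sat (⊖H hY X) (pos s) →
    Σ (List ℕ) λ r → Σ ℕ λ m → s ≡ r ++ [ suc (suc m) ] × PosPrec r ⋖ s × PosPrec r ⋖ (r ++ [ suc m ]) ×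
      Sat X (pos (r ++ [ suc m ]))
  ⊖H-previous-sibling nd (h , _ , c , rh , k , ki , ck , rk , none , x) with χ-to-node nd c rh (inj₁ refl)
  ... | r , a , refl , refl with χ-from-node (prefix r [ suc a ] nd) ck rk (inj₁ refl)
  ...   | m' , ndk , refl with next-⋖-sibling nd (sibling-order ndk nd ki) none
  ...     | refl = r , m' , refl , rh , rk , x

  previous-sibling-⊖H : ∀ {X r m} → Node (r ++ [ suc (suc m) ]) → PosPrec r ⋖ (r ++ [ suc (suc m) ]) →
                        PosPrec r ⋖ (r ++ [ suc m ]) → Sat X (pos (r ++ [ suc m ])) →
                        Sat (⊖H hY X) (pos (r ++ [ suc (suc m) ]))
  previous-sibling-⊖H {r = r} {m} nd l₁ l₂ x =
    pos r , pos-child-< nd , χ-child nd , l₁ , pos (r ++ [ suc m ]) , sibling-< nd (n<1+n _) ,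
    χ-child (previous-sibling nd) , l₂ , (λ k p₁ p₂ (c , _) → no-χ-between-siblings nd c p₁ p₂) , x

  data SiblingUntil (A B : POTL n) (r : List ℕ) : ℕ → Set where
    sib-here : ∀ {m} → Sat B (pos (r ++ [ suc m ])) → SiblingUntil A B r m
    sib-step : ∀ {m} → Sat A (pos (r ++ [ suc m ])) → Node (r ++ [ suc (suc m) ]) →
               PosPrec r ⋖ (r ++ [ suc (suc m) ]) → SiblingUntil A B r (suc m) → SiblingUntil A B r m

  UH-sibling-until : ∀ {A B s} → Node s → Sat (UH hY A B) (pos s) →
                     Σ (List ℕ) λ r → Σ ℕ λ m → s ≡ r ++ [ suc m ] × PosPrec r ⋖ s × SiblingUntil A B r m
  UH-sibling-until {A} {B} nd (ys , (h , _ , (c , rh) ∷ yields , steps) , along) with χ-to-node nd c rh (inj₁ refl)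
  ... | r , m , refl , refl = r , m , refl , rh , go m ys nd yields steps along
    where
    go : ∀ m ys → Node (r ++ [ suc m ]) → All (YieldsTo (pos r)) ys → Consec (YieldStep (pos r)) (pos (r ++ [ suc m ])) ys →
         UAlong (Sat A) (Sat B) (pos (r ++ [ suc m ])) ys → SiblingUntil A B r m
    go m []       nd []                []                b          = sib-here b
    go m (y ∷ ys) nd ((c , ry) ∷ yields) ((lt , none) ∷ steps) (a , along)
      with χ-from-node (prefix r [ suc m ] nd) c ry (inj₁ refl)
    ... | m' , ndy , refl with next-⋖-sibling ndy (sibling-order nd ndy lt) (λ k p₁ p₂ (ck , _) → none k p₁ p₂ ck)
    ...   | refl = sib-step a ndy ry (go (suc m) ys ndy yields steps along)

  sibling-until-UH : ∀ {A B r m} → Node (r ++ [ suc m ]) → PosPrec r ⋖ (r ++ [ suc m ]) → SiblingUntil A B r m →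
                     Sat (UH hY A B) (pos (r ++ [ suc m ]))
  sibling-until-UH {A} {B} {r} nd l su with go su
    where
    go : ∀ {m} → SiblingUntil A B r m → Σ (List ℕ) λ ys → All (YieldsTo (pos r)) ys ×
         Consec (YieldStep (pos r)) (pos (r ++ [ suc m ])) ys × UAlong (Sat A) (Sat B) (pos (r ++ [ suc m ])) ys
    go (sib-here b)            = [] , [] , [] , b
    go (sib-step a nd₂ l₂ su) with go su
    ... | ys , yields , steps , along =
      _ ∷ ys , (χ-child nd₂ , l₂) ∷ yields , between-siblings nd₂ ∷ steps , (a , along)
  ... | ys , yields , steps , along = ys , (pos r , pos-child-< nd , (χ-child nd , l) ∷ yields , steps) , along

  data SiblingSince (A B : POTL n) (r : List ℕ) : ℕ → Set where
    since-here : ∀ {m} → Node (r ++ [ suc m ]) → PosPrec r ⋖ (r ++ [ suc m ]) → Sat B (pos (r ++ [ suc m ])) →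
                 SiblingSince A B r m
    since-step : ∀ {m} → SiblingSince A B r m → Node (r ++ [ suc (suc m) ]) → PosPrec r ⋖ (r ++ [ suc (suc m) ]) →
                 Sat A (pos (r ++ [ suc (suc m) ])) → SiblingSince A B r (suc m)

  SH-sibling-since : ∀ {A B s} → Node s → Sat (SH hY A B) (pos s) →
                     Σ (List ℕ) λ r → Σ ℕ λ m → s ≡ r ++ [ suc m ] × SiblingSince A B r m
  SH-sibling-since {A} {B} nd (j , ys , e , (h , _ , (c , rh) ∷ yields , steps) , b , as)
    with pos-surjective j (U-below-N (proj₁ (proj₂ c)))
  ... | t , ndt , refl with χ-to-node ndt c rh (inj₁ refl)
  ...   | r , m , refl , refl with go m ys ndt yields steps (since-here ndt rh b) as
    where
    go : ∀ m ys → Node (r ++ [ suc m ]) → All (YieldsTo (pos r)) ys → Consec (YieldStep (pos r)) (pos (r ++ [ suc m ])) ys →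
         SiblingSince A B r m → All (Sat A) ys →
         Σ ℕ λ m' → Node (r ++ [ suc m' ]) × pos (r ++ [ suc m' ]) ≡ lastOf (pos (r ++ [ suc m ])) ys × SiblingSince A B r m'
    go m []       nd []                  []                    ss []       = m , nd , refl , ss
    go m (y ∷ ys) nd ((c , ry) ∷ yields) ((lt , none) ∷ steps) ss (a ∷ as)
      with χ-from-node (prefix r [ suc m ] nd) c ry (inj₁ refl)
    ... | m' , ndy , refl with next-⋖-sibling ndy (sibling-order nd ndy lt) (λ k p₁ p₂ (ck , _) → none k p₁ p₂ ck)
    ...   | refl = go (suc m) ys ndy yields steps (since-step ss ndy ry a) as
  ...     | m' , ndm , e' , ss with pos-injective nd ndm (sym (trans e' e))
  ...       | refl = r , m' , refl , ss

  sibling-since-SH : ∀ {A B r m} → SiblingSince A B r m → Sat (SH hY A B) (pos (r ++ [ suc m ]))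
  sibling-since-SH {A} {B} {r} ss with go ss
    where
    go : ∀ {m} → SiblingSince A B r m →
         Σ ℕ λ m₀ → Σ (List ℕ) λ ys → Node (r ++ [ suc m₀ ]) × PosPrec r ⋖ (r ++ [ suc m₀ ]) ×
         lastOf (pos (r ++ [ suc m₀ ])) ys ≡ pos (r ++ [ suc m ]) × All (YieldsTo (pos r)) ys ×
         Consec (YieldStep (pos r)) (pos (r ++ [ suc m₀ ])) ys × Sat B (pos (r ++ [ suc m₀ ])) × All (Sat A) ys
    go {m} (since-here nd l b) = m , [] , nd , l , refl , [] , [] , b , []
    go {suc m} (since-step ss nd₂ l₂ a) with go ss
    ... | m₀ , ys , nd₀ , l₀ , e , yields , steps , b , as =
      m₀ , ys ++ [ pos (r ++ [ suc (suc m) ]) ] , nd₀ , l₀ , lastOf-snoc _ ys _ , all-snoc yields (χ-child nd₂ , l₂) ,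
      consec-snoc steps (subst (λ z → YieldStep (pos r) z (pos (r ++ [ suc (suc m) ]))) (sym e) (between-siblings nd₂)) ,
      b , all-snoc as a
  ... | m₀ , ys , nd₀ , l₀ , e , yields , steps , b , as =
    pos (r ++ [ suc m₀ ]) , ys , e , (pos r , pos-child-< nd₀ , (χ-child nd₀ , l₀) ∷ yields , steps) , b , as

  -- Runs of siblings.  Below, indices are the raw child indices: the children
  -- involved are r·h, …, r·t, all with index > 0 (first children are never
  -- reached by a chain from their parent).
  interval-sibling-until : ∀ {A B r m t} → m ≤ t → Node (r ++ [ suc t ]) → PosPrec r ⋖ (r ++ [ suc t ]) →
                           Sat B (pos (r ++ [ suc t ])) → (∀ j → m ≤ j → j < t → Sat A (pos (r ++ [ suc j ]))) →
                           SiblingUntil A B r m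
  interval-sibling-until {A} {B} {r} {m} {t} m≤t nd last-⋖ b as = go (t ∸ m) m (sym (m∸n+n≡m m≤t)) as
    where
    go : ∀ d m → t ≡ d + m → (∀ j → m ≤ j → j < t → Sat A (pos (r ++ [ suc j ]))) → SiblingUntil A B r m
    go zero    m refl as = sib-here b
    go (suc d) m e    as =
      sib-step (as m ≤-refl m<t) (earlier-sibling nd (s≤s m<t)) next-⋖
               (go d (suc m) (trans e (sym (+-suc d m))) λ j p q → as j (<⇒≤ p) q)
      where
      m<t : m < t
      m<t = subst (m <_) (sym e) (s≤s (m≤n+m m d))
      next-⋖ : PosPrec r ⋖ (r ++ [ suc (suc m) ])
      next-⋖ with m≤n⇒m<n∨m≡n m<t
      ... | inj₁ q    = non-last-⋖ nd (s≤s q)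
      ... | inj₂ refl = last-⋖

  sibling-until-interval : ∀ {A B r m} → Node (r ++ [ suc m ]) → SiblingUntil A B r m →
    Σ ℕ λ t → m ≤ t × Node (r ++ [ suc t ]) × Sat B (pos (r ++ [ suc t ])) ×
      (∀ j → m ≤ j → j < t → Sat A (pos (r ++ [ suc j ]))) × (m < t → PosPrec r ⋖ (r ++ [ suc t ]))
  sibling-until-interval {m = m} nd (sib-here b) =
    m , ≤-refl , nd , b , (λ j p q → ⊥-elim (<-irrefl refl (≤-trans q p))) , λ p → ⊥-elim (<-irrefl refl p)
  sibling-until-interval {A} {B} {r} {m} nd (sib-step a nd₂ l su) with sibling-until-interval nd₂ su
  ... | t , p , ndt , b , as , last-⋖ = t , <⇒≤ p , ndt , b , as' , last-⋖'
    where
    as' : ∀ j → m ≤ j → j < t → Sat A (pos (r ++ [ suc j ]))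
    as' j q₁ q₂ with m≤n⇒m<n∨m≡n q₁
    ... | inj₂ refl = a
    ... | inj₁ q    = as j q q₂
    last-⋖' : m < t → PosPrec r ⋖ (r ++ [ suc t ])
    last-⋖' _ with m≤n⇒m<n∨m≡n p
    ... | inj₁ q    = last-⋖ q
    ... | inj₂ refl = l

  interval-sibling-since : ∀ {A B r} t m → t ≤ m → Node (r ++ [ suc m ]) → PosPrec r ⋖ (r ++ [ suc m ]) →
                           Sat B (pos (r ++ [ suc t ])) → (∀ j → t < j → j ≤ m → Sat A (pos (r ++ [ suc j ]))) →
                           SiblingSince A B r m
  interval-sibling-since t m t≤m nd last-⋖ b as with m≤n⇒m<n∨m≡n t≤m
  ... | inj₂ refl = since-here nd last-⋖ b
  interval-sibling-since t (suc m) t≤m nd last-⋖ b as | inj₁ q =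
    since-step (interval-sibling-since t m (≤-pred q) (previous-sibling nd) (non-last-⋖ nd ≤-refl) b
                  (λ j x y → as j x (≤-trans y (n≤1+n m))))
               nd last-⋖ (as (suc m) q ≤-refl)

  sibling-since-interval : ∀ {A B r m} → SiblingSince A B r m →
    Σ ℕ λ t → t ≤ m × Node (r ++ [ suc t ]) × Sat B (pos (r ++ [ suc t ])) ×
      (∀ j → t < j → j ≤ m → Sat A (pos (r ++ [ suc j ])))
  sibling-since-interval {m = m} (since-here nd l b) = m , ≤-refl , nd , b , λ j p q → ⊥-elim (<-irrefl refl (≤-trans p q))
  sibling-since-interval {A} {B} {r} {suc m} (since-step ss nd l a) with sibling-since-interval ss
  ... | t , p , ndt , b , as = t , ≤-trans p (n≤1+n m) , ndt , b , as'
    where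
    as' : ∀ j → t < j → j ≤ suc m → Sat A (pos (r ++ [ suc j ]))
    as' j q₁ q₂ with m≤n⇒m<n∨m≡n q₂
    ... | inj₂ refl = a
    ... | inj₁ q    = as j q₁ (≤-pred q)

  run-to-○HUH : ∀ {A B r h t} → Node (r ++ [ t ]) → 0 < h → h < t → PosPrec r ⋖ (r ++ [ t ]) →
                Sat B (pos (r ++ [ t ])) →
                (∀ j → h < j → j < t → Sat A (pos (r ++ [ j ]))) → Sat (○H hY (UH hY A B)) (pos (r ++ [ h ]))
  run-to-○HUH {A} {B} {r} {suc m} {suc t} nd _ (s≤s m<t) last-⋖ b as =
    next-sibling-○H {X = UH hY A B} nd₂ (non-last-⋖ nd (s≤s m<t)) next-⋖
      (sibling-until-UH nd₂ next-⋖ (interval-sibling-until {A} {B} m<t nd last-⋖ b (λ j p q → as (suc j) (s≤s p) (s≤s q))))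
    where
    nd₂ = earlier-sibling nd (s≤s m<t)
    next-⋖ : PosPrec r ⋖ (r ++ [ suc (suc m) ])
    next-⋖ with m≤n⇒m<n∨m≡n m<t
    ... | inj₁ q    = non-last-⋖ nd (s≤s q)
    ... | inj₂ refl = last-⋖

  ○HUH-to-run : ∀ {A B r h} → Node (r ++ [ h ]) → Sat (○H hY (UH hY A B)) (pos (r ++ [ h ])) →
    Σ ℕ λ t → h < t × Node (r ++ [ t ]) × PosPrec r ⋖ (r ++ [ t ]) × Sat B (pos (r ++ [ t ])) ×
      (∀ j → h < j → j < t → Sat A (pos (r ++ [ j ])))
  ○HUH-to-run {A} {B} {r} nd x with ○H-next-sibling {X = UH hY A B} nd x
  ... | r' , m , e , _ , nd₂ , l₂ , u with snoc-injective e
  ...   | refl , refl with UH-sibling-until {A} {B} nd₂ u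
  ...     | r'' , m' , e' , _ , su with snoc-injective e'
  ...       | refl , refl with sibling-until-interval {A} {B} nd₂ su
  ...         | t , q , ndt , b , as , last-⋖ = suc t , s≤s q , ndt , t-⋖ , b , as'
    where
    t-⋖ : PosPrec r ⋖ (r ++ [ suc t ])
    t-⋖ with m≤n⇒m<n∨m≡n q
    ... | inj₁ q'   = last-⋖ q'
    ... | inj₂ refl = l₂
    as' : ∀ j → suc m < j → j < suc t → Sat A (pos (r ++ [ j ]))
    as' (suc j) (s≤s p) (s≤s q') = as j p q'

  run-to-SH : ∀ {A B r t m} → 0 < t → t ≤ m → Node (r ++ [ m ]) → PosPrec r ⋖ (r ++ [ m ]) → Sat B (pos (r ++ [ t ])) →
              (∀ j → t < j → j ≤ m → Sat A (pos (r ++ [ j ]))) → Sat (SH hY A B) (pos (r ++ [ m ]))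
  run-to-SH {A} {B} {t = suc t} {suc m} _ (s≤s t≤m) nd last-⋖ b as =
    sibling-since-SH (interval-sibling-since {A} {B} t m t≤m nd last-⋖ b (λ j p q → as (suc j) (s≤s p) (s≤s q)))

  SH-to-run : ∀ {A B r m} → Node (r ++ [ m ]) → Sat (SH hY A B) (pos (r ++ [ m ])) →
    Σ ℕ λ t → 0 < t × t ≤ m × Node (r ++ [ t ]) × Sat B (pos (r ++ [ t ])) ×
      (∀ j → t < j → j ≤ m → Sat A (pos (r ++ [ j ])))
  SH-to-run {A} {B} {r} nd x with SH-sibling-since {A} {B} nd x
  ... | r' , m , e , ss with snoc-injective e
  ...   | refl , refl with sibling-since-interval {A} {B} ss
  ...     | t , q , ndt , b , as = suc t , s≤s z≤n , s≤s q , ndt , b , as'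
    where
    as' : ∀ j → suc t < j → j ≤ suc m → Sat A (pos (r ++ [ j ]))
    as' (suc j) (s≤s p) (s≤s q') = as j p q'

  run-to-⊖HSH : ∀ {A B r h t} → Node (r ++ [ h ]) → PosPrec r ⋖ (r ++ [ h ]) → 0 < t → t < h →
                Sat B (pos (r ++ [ t ])) →
                (∀ j → t < j → j < h → Sat A (pos (r ++ [ j ]))) → Sat (⊖H hY (SH hY A B)) (pos (r ++ [ h ]))
  run-to-⊖HSH {A} {B} {h = suc (suc m)} nd l 0<t (s≤s t≤m) b as =
    previous-sibling-⊖H {X = SH hY A B} nd l (non-last-⋖ nd ≤-refl)
      (run-to-SH {A} {B} 0<t t≤m (previous-sibling nd) (non-last-⋖ nd ≤-refl) b (λ j p q → as j p (s≤s q)))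
  run-to-⊖HSH {h = suc zero} nd l (s≤s z≤n) (s≤s ()) b as

  ⊖HSH-to-run : ∀ {A B r h} → Node (r ++ [ h ]) → Sat (⊖H hY (SH hY A B)) (pos (r ++ [ h ])) →
    Σ ℕ λ t → 0 < t × t < h × Node (r ++ [ t ]) × Sat B (pos (r ++ [ t ])) ×
      (∀ j → t < j → j < h → Sat A (pos (r ++ [ j ])))
  ⊖HSH-to-run {A} {B} nd x with ⊖H-previous-sibling {X = SH hY A B} nd x
  ... | r' , m , e , _ , _ , sh with snoc-injective e
  ...   | refl , refl with SH-to-run {A} {B} (previous-sibling nd) sh
  ...     | t , 0<t , t≤m , ndt , b , as = t , 0<t , s≤s t≤m , ndt , b , λ j p q → as j p (≤-pred q)

  no-next-⋖-sibling : ∀ {r a b} → Node (r ++ [ b ]) → suc a < b → ¬ Sat (○H hY ⊤ₚ) (pos (r ++ [ suc a ])) →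
                      b ≡ suc (suc a)
  no-next-⋖-sibling {r} {a} {suc b} nd (s≤s a<b) none with m≤n⇒m<n∨m≡n a<b
  ... | inj₂ refl = refl
  ... | inj₁ q    = ⊥-elim (none (next-sibling-○H {X = ⊤ₚ} (earlier-sibling nd (<⇒≤ (s≤s q)))
                                    (non-last-⋖ nd (s≤s a<b)) (non-last-⋖ nd (s≤s q)) tt))


module TreeUntil {n : ℕ} (T : Tree n) where
  open NodePositions T

  -- The last index of an address (0 for the root) grows by one along R⇒.
  last-index : List ℕ → ℕ
  last-index []           = 0
  last-index (x ∷ [])     = x
  last-index (x ∷ y ∷ ys) = last-index (y ∷ ys)

  last-index-snoc : ∀ r h → last-index (r ++ [ h ]) ≡ h
  last-index-snoc []          h = refl
  last-index-snoc (x ∷ [])    h = refl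
  last-index-snoc (x ∷ y ∷ r) h = last-index-snoc (y ∷ r) h

  last-index-step : ∀ {s t} → R⇒ T s t → last-index t ≡ suc (last-index s)
  last-index-step (_ , _ , r , h , refl , refl) = trans (last-index-snoc r (suc h)) (cong suc (sym (last-index-snoc r h)))

  descendant-shape : ∀ {s t} → TransClosure (R⇓ T) s t → Σ ℕ λ k → Σ (List ℕ) λ u → t ≡ s ++ (k ∷ u)
  descendant-shape ⟪ (_ , _ , k , refl) ⟫ = k , [] , refl
  descendant-shape {s} ((_ , _ , k , refl) ∷ c) with descendant-shape c
  ... | k' , u , refl = k , k' ∷ u , ++-assoc s [ k ] (k' ∷ u)

  descendant-path : ∀ s k u → Node (s ++ (k ∷ u)) → TransClosure (R⇓ T) s (s ++ (k ∷ u))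
  descendant-path s k []       nd = ⟪ (unNode (prefix s [ k ] nd) , unNode nd , k , refl) ⟫
  descendant-path s k (k' ∷ u) nd =
    subst (TransClosure (R⇓ T) s) (++-assoc s [ k ] (k' ∷ u))
      ((unNode (prefix s (k ∷ k' ∷ u) nd) , unNode (prefix (s ++ [ k ]) (k' ∷ u) nd') , k , refl)
        ∷ descendant-path (s ++ [ k ]) k' u nd')
    where
    nd' : Node ((s ++ [ k ]) ++ (k' ∷ u))
    nd' = subst Node (sym (++-assoc s [ k ] (k' ∷ u))) nd

  tc-node : ∀ {Rel : List ℕ → List ℕ → Set} → (∀ {x y} → Rel x y → Node y) →
            ∀ {s t} → TransClosure Rel s t → Node t
  tc-node target ⟪ r ⟫   = target r
  tc-node target (r ∷ c) = tc-node target c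

  through⇓ : ThroughSuccessor (R⇓ T)
  through⇓ {s} (_ , _ , k , refl) c₁ c₂ c₃ with descendant-shape c₁ | descendant-shape c₂ | descendant-shape c₃
  ... | k₁ , u₁ , refl | a , v , refl | b , w , e₃ =
    below v (++-cancelˡ s (k ∷ k₁ ∷ u₁) (a ∷ v ++ b ∷ w)
               (trans (sym (++-assoc s [ k ] (k₁ ∷ u₁))) (trans e₃ (++-assoc s (a ∷ v) (b ∷ w))))) c₂
    where
    below : ∀ v → (k ∷ k₁ ∷ u₁) ≡ (a ∷ v ++ b ∷ w) → TransClosure (R⇓ T) s (s ++ (a ∷ v)) →
            (s ++ (a ∷ v)) ≡ (s ++ [ k ]) ⊎ TransClosure (R⇓ T) (s ++ [ k ]) (s ++ (a ∷ v))
    below []       refl _  = inj₁ refl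
    below (c ∷ v') refl c₂ =
      inj₂ (subst (TransClosure (R⇓ T) (s ++ [ k ])) (++-assoc s [ k ] (c ∷ v'))
              (descendant-path (s ++ [ k ]) c v'
                (subst Node (sym (++-assoc s [ k ] (c ∷ v'))) (tc-node (λ { (_ , x , _) → isNode x }) c₂))))

  functional⇑ : ∀ {x y y'} → R D⇑ T x y → R D⇑ T x y' → y ≡ y'
  functional⇑ (_ , _ , k , e₁) (_ , _ , k' , e₂) = proj₁ (snoc-injective (trans (sym e₁) e₂))

  functional⇒ : ∀ {x y y'} → R D⇒ T x y → R D⇒ T x y' → y ≡ y'
  functional⇒ (_ , _ , r , h , refl , refl) (_ , _ , r' , h' , e , refl) with snoc-injective e
  ... | refl , refl = refl

  functional⇐ : ∀ {x y y'} → R D⇐ T x y → R D⇐ T x y' → y ≡ y'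
  functional⇐ (_ , _ , r , h , refl , e₁) (_ , _ , r' , h' , refl , e₂) with snoc-injective (trans (sym e₁) e₂)
  ... | refl , refl = refl

  until⇔unfold : ∀ ρ {Φ Ψ s} → TCUntil (R ρ T) Φ Ψ s ⇔ Unfold (R ρ T) Φ Ψ s
  until⇔unfold D⇓ = mk⇔ (TCUntil⇒Unfold _)
    (Unfold⇒TCUntil _ (no-detour-rank-inc _ length (λ { {x} (_ , _ , k , refl) → length-snoc x k })) through⇓)
  until⇔unfold D⇑ = mk⇔ (TCUntil⇒Unfold _)
    (Unfold⇒TCUntil _ (no-detour-rank-dec _ length (λ { {y = y} (_ , _ , k , refl) → length-snoc y k }))
                      (through-functional _ functional⇑))
  until⇔unfold D⇒ = mk⇔ (TCUntil⇒Unfold _)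
    (Unfold⇒TCUntil _ (no-detour-rank-inc _ last-index last-index-step) (through-functional _ functional⇒))
  until⇔unfold D⇐ = mk⇔ (TCUntil⇒Unfold _)
    (Unfold⇒TCUntil _ (no-detour-rank-dec _ last-index last-index-step) (through-functional _ functional⇐))

  RightWitness : (List ℕ → Set) → (List ℕ → Set) → List ℕ → ℕ → Set
  RightWitness Φ Ψ r h =
    Σ ℕ λ t → h < t × Node (r ++ [ t ]) × Ψ (r ++ [ t ]) × (∀ j → h < j → j < t → Φ (r ++ [ j ]))

  LeftWitness : (List ℕ → Set) → (List ℕ → Set) → List ℕ → ℕ → Set
  LeftWitness Φ Ψ r h = Σ ℕ λ t → t < h × Ψ (r ++ [ t ]) × (∀ j → t < j → j < h → Φ (r ++ [ j ]))

  Unfold⇒RightWitness : ∀ {Φ Ψ s} → Unfold (R D⇒ T) Φ Ψ s → ∀ r h → s ≡ r ++ [ h ] → RightWitness Φ Ψ r h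
  Unfold⇒RightWitness (now (_ , ndy , r' , h' , e , refl) p) r h e' with snoc-injective (trans (sym e) e')
  ... | refl , refl = suc h , ≤-refl , isNode ndy , p , λ j p₁ p₂ → ⊥-elim (<-irrefl refl (≤-trans p₂ p₁))
  Unfold⇒RightWitness {Φ} (later (_ , ndy , r' , h' , e , refl) f u) r h e' with snoc-injective (trans (sym e) e')
  ... | refl , refl with Unfold⇒RightWitness u r (suc h) refl
  ...   | t , lt , nd , p , fs = t , <-trans (n<1+n h) lt , nd , p , between
    where
    between : ∀ j → h < j → j < t → Φ (r ++ [ j ])
    between j p₁ p₂ with m≤n⇒m<n∨m≡n p₁
    ... | inj₂ refl = f
    ... | inj₁ q    = fs j q p₂

  RightWitness⇒Unfold : ∀ {Φ Ψ r h} → Node (r ++ [ h ]) → RightWitness Φ Ψ r h → Unfold (R D⇒ T) Φ Ψ (r ++ [ h ])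
  RightWitness⇒Unfold {Φ} {Ψ} {r} {h} nd (t , lt , ndt , p , fs) =
    go (t ∸ suc h) h nd (trans (sym (m+[n∸m]≡n lt)) (+-comm (suc h) _)) fs
    where
    go : ∀ d h → Node (r ++ [ h ]) → t ≡ d + suc h → (∀ j → h < j → j < t → Φ (r ++ [ j ])) →
         Unfold (R D⇒ T) Φ Ψ (r ++ [ h ])
    go zero    h nd refl fs = now (unNode nd , unNode ndt , r , h , refl , refl) p
    go (suc d) h nd e    fs =
      later (unNode nd , unNode nd' , r , h , refl , refl) (fs (suc h) ≤-refl q)
            (go d (suc h) nd' (trans e (sym (+-suc d (suc h)))) (λ j p₁ p₂ → fs j (<-trans (n<1+n h) p₁) p₂))
      where
      q : suc h < t
      q = subst (suc h <_) (sym e) (s≤s (m≤n+m (suc h) d))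
      nd' = earlier-sibling ndt (<⇒≤ q)

  Unfold⇒LeftWitness : ∀ {Φ Ψ s} → Unfold (R D⇐ T) Φ Ψ s → ∀ r h → s ≡ r ++ [ h ] → LeftWitness Φ Ψ r h
  Unfold⇒LeftWitness (now (ndy , _ , r' , h' , refl , e) p) r h e' with snoc-injective (trans (sym e) e')
  ... | refl , refl = h' , ≤-refl , p , λ j p₁ p₂ → ⊥-elim (<-irrefl refl (≤-trans p₂ p₁))
  Unfold⇒LeftWitness {Φ} (later (ndy , _ , r' , h' , refl , e) f u) r h e' with snoc-injective (trans (sym e) e')
  ... | refl , refl with Unfold⇒LeftWitness u r h' refl
  ...   | t , lt , p , fs = t , <-trans lt (n<1+n h') , p , between
    where
    between : ∀ j → t < j → j < suc h' → Φ (r ++ [ j ])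
    between j p₁ p₂ with m≤n⇒m<n∨m≡n (≤-pred p₂)
    ... | inj₂ refl = f
    ... | inj₁ q    = fs j p₁ q

  LeftWitness⇒Unfold : ∀ {Φ Ψ r h} → Node (r ++ [ h ]) → LeftWitness Φ Ψ r h → Unfold (R D⇐ T) Φ Ψ (r ++ [ h ])
  LeftWitness⇒Unfold {Φ} {Ψ} {r} {h} nd (t , lt , p , fs) = go h nd lt fs
    where
    go : ∀ h → Node (r ++ [ h ]) → t < h → (∀ j → t < j → j < h → Φ (r ++ [ j ])) →
         Unfold (R D⇐ T) Φ Ψ (r ++ [ h ])
    go (suc h) nd lt fs with m≤n⇒m<n∨m≡n (≤-pred lt)
    ... | inj₂ refl = now (unNode (previous-sibling nd) , unNode nd , r , t , refl , refl) p
    ... | inj₁ q    = later (unNode (previous-sibling nd) , unNode nd , r , h , refl , refl) (fs h q ≤-refl)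
                            (go h (previous-sibling nd) q (λ j p₁ p₂ → fs j p₁ (<-trans p₂ (n<1+n h))))

  no-right-at-root : ∀ {Φ Ψ} → ¬ Unfold (R D⇒ T) Φ Ψ []
  no-right-at-root (now   (_ , _ , r , h , e , _) _)   = []≢snoc r h e
  no-right-at-root (later (_ , _ , r , h , e , _) _ _) = []≢snoc r h e

  no-left-at-root : ∀ {Φ Ψ} → ¬ Unfold (R D⇐ T) Φ Ψ []
  no-left-at-root (now   (_ , _ , r , h , _ , e) _)   = []≢snoc r (suc h) e
  no-left-at-root (later (_ , _ , r , h , _ , e) _ _) = []≢snoc r (suc h) e

  right⇔witness : ∀ {Φ Ψ r h} → Node (r ++ [ h ]) → TCUntil (R D⇒ T) Φ Ψ (r ++ [ h ]) ⇔ RightWitness Φ Ψ r h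
  right⇔witness nd = mk⇔ (λ x → Unfold⇒RightWitness (Equivalence.to (until⇔unfold D⇒) x) _ _ refl)
                         (λ w → Equivalence.from (until⇔unfold D⇒) (RightWitness⇒Unfold nd w))

  left⇔witness : ∀ {Φ Ψ r h} → Node (r ++ [ h ]) → TCUntil (R D⇐ T) Φ Ψ (r ++ [ h ]) ⇔ LeftWitness Φ Ψ r h
  left⇔witness nd = mk⇔ (λ x → Unfold⇒LeftWitness (Equivalence.to (until⇔unfold D⇐) x) _ _ refl)
                        (λ w → Equivalence.from (until⇔unfold D⇐) (LeftWitness⇒Unfold nd w))

  right-at-root : ∀ {Φ Ψ} → ¬ TCUntil (R D⇒ T) Φ Ψ []
  right-at-root x = no-right-at-root (Equivalence.to (until⇔unfold D⇒) x)

  left-at-root : ∀ {Φ Ψ} → ¬ TCUntil (R D⇐ T) Φ Ψ []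
  left-at-root x = no-left-at-root (Equivalence.to (until⇔unfold D⇐) x)

  -- Unfoldings are decidable when Φ and Ψ are decidable at nodes: they only
  -- inspect the finitely many children, ancestors or siblings of a node.
  module UnfoldDecidable (Φ Ψ : List ℕ → Set) (Φ? : ∀ t → Node t → Dec (Φ t)) (Ψ? : ∀ t → Node t → Dec (Ψ t)) where

    unfold⇓? : ∀ f s → sz s ≤ f → Node s → Dec (Unfold (R D⇓ T) Φ Ψ s)
    unfold⇓? zero    s le nd = ⊥-elim (sz≰0 nd le)
    unfold⇓? (suc f) s le nd with children nd
    ... | m , ch = map′ to from (bounded-∃? m P P?)
      where
      P : ℕ → Set
      P k = Ψ (s ++ [ k ]) ⊎ (Φ (s ++ [ k ]) × Unfold (R D⇓ T) Φ Ψ (s ++ [ k ]))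
      P? : ∀ k → k < m → Dec (P k)
      P? k p = Ψ? _ ndk ⊎-dec (Φ? _ ndk ×-dec unfold⇓? f (s ++ [ k ]) (≤-pred (≤-trans (sz-child-< ndk) le)) ndk)
        where ndk = proj₂ (ch k) p
      to : (∃ λ k → k < m × P k) → Unfold (R D⇓ T) Φ Ψ s
      to (k , p , inj₁ x)       = now (unNode nd , unNode (proj₂ (ch k) p) , k , refl) x
      to (k , p , inj₂ (x , u)) = later (unNode nd , unNode (proj₂ (ch k) p) , k , refl) x u
      from : Unfold (R D⇓ T) Φ Ψ s → ∃ λ k → k < m × P k
      from (now (_ , ndy , k , refl) x)     = k , proj₁ (ch k) (isNode ndy) , inj₁ x
      from (later (_ , ndy , k , refl) x u) = k , proj₁ (ch k) (isNode ndy) , inj₂ (x , u)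

    unfold⇑? : ∀ f s → length s ≤ f → Node s → Dec (Unfold (R D⇑ T) Φ Ψ s)
    unfold⇑? f s le nd with initLast s
    ... | [] = no λ { (now (_ , _ , k , e) _) → []≢snoc _ k e ; (later (_ , _ , k , e) _ _) → []≢snoc _ k e }
    unfold⇑? zero .(r ++ [ h ]) le nd | r ∷ʳ′ h with subst (_≤ 0) (length-snoc r h) le
    ... | ()
    unfold⇑? (suc f) .(r ++ [ h ]) le nd | r ∷ʳ′ h =
      map′ to from (Ψ? r ndr ⊎-dec (Φ? r ndr ×-dec unfold⇑? f r (≤-pred (subst (_≤ suc f) (length-snoc r h) le)) ndr))
      where
      ndr = prefix r [ h ] nd
      to : Ψ r ⊎ (Φ r × Unfold (R D⇑ T) Φ Ψ r) → Unfold (R D⇑ T) Φ Ψ (r ++ [ h ])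
      to (inj₁ x)       = now (unNode ndr , unNode nd , h , refl) x
      to (inj₂ (x , u)) = later (unNode ndr , unNode nd , h , refl) x u
      from : Unfold (R D⇑ T) Φ Ψ (r ++ [ h ]) → Ψ r ⊎ (Φ r × Unfold (R D⇑ T) Φ Ψ r)
      from (now (_ , _ , k , e) x) with snoc-injective e
      ... | refl , refl = inj₁ x
      from (later (_ , _ , k , e) x u) with snoc-injective e
      ... | refl , refl = inj₂ (x , u)

    between? : ∀ r m a b → (∀ j → j < m → Node (r ++ [ j ])) → b ≤ m → Dec (∀ j → a < j → j < b → Φ (r ++ [ j ]))
    between? r m a b node-below b≤m =
      map′ (λ f j p₁ p₂ → f j p₂ p₁) (λ f j p₂ p₁ → f j p₁ p₂) (bounded-∀? b _ step?)
      where
      step? : ∀ j → j < b → Dec (a < j → Φ (r ++ [ j ]))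
      step? j q with a <? j
      ... | yes aj = map′ (λ x _ → x) (λ f → f aj) (Φ? _ (node-below j (<-≤-trans q b≤m)))
      ... | no aj  = yes λ x → ⊥-elim (aj x)

    right-witness? : ∀ r h → Node (r ++ [ h ]) → Dec (RightWitness Φ Ψ r h)
    right-witness? r h nd with children (prefix r [ h ] nd)
    ... | m , ch = map′ to from (bounded-∃? m P P?)
      where
      P : ℕ → Set
      P t = h < t × Ψ (r ++ [ t ]) × (∀ j → h < j → j < t → Φ (r ++ [ j ]))
      P? : ∀ t → t < m → Dec (P t)
      P? t p = (h <? t) ×-dec (Ψ? _ (proj₂ (ch t) p) ×-dec between? r m h t (λ j → proj₂ (ch j)) (<⇒≤ p))
      to : (∃ λ t → t < m × P t) → RightWitness Φ Ψ r h
      to (t , p , lt , x , f) = t , lt , proj₂ (ch t) p , x , f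
      from : RightWitness Φ Ψ r h → ∃ λ t → t < m × P t
      from (t , lt , ndt , x , f) = t , proj₁ (ch t) ndt , lt , x , f

    left-witness? : ∀ r h → Node (r ++ [ h ]) → Dec (LeftWitness Φ Ψ r h)
    left-witness? r h nd = bounded-∃? h _ P?
      where
      P? : ∀ t → t < h → Dec (Ψ (r ++ [ t ]) × (∀ j → t < j → j < h → Φ (r ++ [ j ])))
      P? t p = Ψ? _ (earlier-sibling nd (<⇒≤ p)) ×-dec between? r h t h (λ j q → earlier-sibling nd (<⇒≤ q)) ≤-refl

    unfold⇒? : ∀ s → Node s → Dec (Unfold (R D⇒ T) Φ Ψ s)
    unfold⇒? s nd with initLast s
    ... | []      = no no-right-at-root
    ... | r ∷ʳ′ h = map′ (RightWitness⇒Unfold nd) (λ u → Unfold⇒RightWitness u r h refl) (right-witness? r h nd)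

    unfold⇐? : ∀ s → Node s → Dec (Unfold (R D⇐ T) Φ Ψ s)
    unfold⇐? s nd with initLast s
    ... | []      = no no-left-at-root
    ... | r ∷ʳ′ h = map′ (LeftWitness⇒Unfold nd) (λ u → Unfold⇒LeftWitness u r h refl) (left-witness? r h nd)

  ∈L? : ∀ p (l : Label n) → Dec (p ∈L l)
  ∈L? p ♯             = no λ ()
  ∈L? p (Label.sym a) = p ∈? a

  XSat? : ∀ φ s → Node s → Dec (XSat T φ s)
  XSat? (prop p)        s nd = ∈L? p (lab T s)
  XSat? ⊤ₓ              s nd = yes tt
  XSat? (¬ₓ φ)          s nd = ¬? (XSat? φ s nd)
  XSat? (φ ∧ₓ ψ)        s nd = XSat? φ s nd ×-dec XSat? ψ s nd
  XSat? (until ρ φ ψ)   s nd = map′ from to (unfold? ρ)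
    where
    open UnfoldDecidable (XSat T φ) (XSat T ψ) (XSat? φ) (XSat? ψ)
    open Equivalence (until⇔unfold ρ {XSat T φ} {XSat T ψ} {s})
    unfold? : ∀ ρ → Dec (Unfold (R ρ T) (XSat T φ) (XSat T ψ) s)
    unfold? D⇓ = unfold⇓? (sz s) s ≤-refl nd
    unfold? D⇑ = unfold⇑? (length s) s ≤-refl nd
    unfold? D⇒ = unfold⇒? s nd
    unfold? D⇐ = unfold⇐? s nd

  XSat-stable : ∀ φ s → Node s → ¬ ¬ XSat T φ s → XSat T φ s
  XSat-stable φ s nd nn with XSat? φ s nd
  ... | yes x = x
  ... | no x  = ⊥-elim (nn x)

module Translation {n : ℕ} {isS : Fin n → Bool} (M : OPM n isS) (T : Tree n) (tm : InTM M T) where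
  open TreeModalities M T tm
  open TreeUntil T

  Agrees : XU n → Set
  Agrees φ = ∀ {t} → Node t → XSat T φ t ⇔ Sat (ι φ) (pos t)

  module UntilCases (φ ψ : XU n) (agree-φ : Agrees φ) (agree-ψ : Agrees ψ) where
    Φ Ψ : List ℕ → Set
    Φ = XSat T φ
    Ψ = XSat T ψ

    A B : POTL n
    A = ι φ
    B = ι ψ

    φ→A : ∀ {t} → Node t → Φ t → Sat A (pos t)
    φ→A nd = Equivalence.to (agree-φ nd)

    A→φ : ∀ {t} → Node t → Sat A (pos t) → Φ t
    A→φ nd = Equivalence.from (agree-φ nd)

    ψ→B : ∀ {t} → Node t → Ψ t → Sat B (pos t)
    ψ→B nd = Equivalence.to (agree-ψ nd)

    B→ψ : ∀ {t} → Node t → Sat B (pos t) → Ψ t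
    B→ψ nd = Equivalence.from (agree-ψ nd)

    φ-unless : ∀ {t} → Node t → ¬ Sat (¬ₚ A) (pos t) → Φ t
    φ-unless nd no-¬A = XSat-stable φ _ nd λ ¬φ → no-¬A λ a → ¬φ (A→φ nd a)

    -- The negated guards of ι(⇒(φ,ψ)) and ι(⇐(φ,ψ)): φ fails at a later
    -- ⋖-sibling, at an earlier ⋖-sibling, or at a ⋖-child.
    ViolationAfter ViolationBefore ViolationBelow : POTL n
    ViolationAfter  = ○H hY (UH hY ⊤ₚ (¬ₚ A))
    ViolationBefore = ⊖H hY (SH hY ⊤ₚ (¬ₚ A))
    ViolationBelow  = χF Π⋖ (¬ₚ A)

    ChildDownUntil : List ℕ → Set
    ChildDownUntil s = Σ ℕ λ k → Node (s ++ [ k ]) × DownUntil A B (s ++ [ k ])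

    unfold⇒down : ∀ {s} → Unfold (R D⇓ T) Φ Ψ s → ChildDownUntil s
    unfold⇒down (now (_ , ndy , k , refl) p) = k , isNode ndy , down-here (ψ→B (isNode ndy) p)
    unfold⇒down (later (_ , ndy , k , refl) f u) with unfold⇒down u
    ... | k' , nd' , du = k , isNode ndy , down-step k' (φ→A (isNode ndy) f) nd' du

    down⇒unfold : ∀ {s k} → Node (s ++ [ k ]) → DownUntil A B (s ++ [ k ]) → Unfold (R D⇓ T) Φ Ψ s
    down⇒unfold {s} {k} nd (down-here b) =
      now (unNode (prefix s [ k ] nd) , unNode nd , k , refl) (B→ψ nd b)
    down⇒unfold {s} {k} nd (down-step k' a nd' du) =
      later (unNode (prefix s [ k ] nd) , unNode nd , k , refl) (A→φ nd a) (down⇒unfold nd' du)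

    -- On the word side the first step goes to the first child (○) or a later one (χ_F).
    correct⇓ : Agrees (until D⇓ φ ψ)
    correct⇓ {s} nd = mk⇔ (λ x → to-word (unfold⇒down (Equivalence.to (until⇔unfold D⇓) x)))
                          (λ y → let (k , ndk , du) = from-word y in Equivalence.from (until⇔unfold D⇓) (down⇒unfold ndk du))
      where
      to-word : ChildDownUntil s → Sat (ι (until D⇓ φ ψ)) (pos s)
      to-word (zero  , nd0 , du) = inj₁ (first-child-○ {X = Uχ Π⋖≐ A B} nd0 (child-prec-⋖≐ nd0) (DownUntil⇒Uχ nd0 du))
      to-word (suc k , ndk , du) = inj₂ (later-child-χF {X = Uχ Π⋖≐ A B} ndk (child-prec-⋖≐ ndk) (DownUntil⇒Uχ ndk du))
      from-word : Sat (ι (until D⇓ φ ψ)) (pos s) → ChildDownUntil s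
      from-word (inj₁ x) with ○-first-child {X = Uχ Π⋖≐ A B} nd ⋖≐-below x
      ... | nd0 , _ , u = 0 , nd0 , Uχ⇒DownUntil nd0 u
      from-word (inj₂ x) with χF-later-child {X = Uχ Π⋖≐ A B} nd ⋖≐-below x
      ... | k , ndk , _ , u = suc k , ndk , Uχ⇒DownUntil ndk u

    ParentUpSince : List ℕ → Set
    ParentUpSince s = Σ (List ℕ) λ y → Σ ℕ λ k → s ≡ y ++ [ k ] × UpSince A B y

    unfold⇒up : ∀ {s} → Unfold (R D⇑ T) Φ Ψ s → ParentUpSince s
    unfold⇒up (now (ndy , _ , k , refl) p) = _ , k , refl , up-here (ψ→B (isNode ndy) p)
    unfold⇒up (later (ndy , _ , k , refl) f u) with unfold⇒up u
    ... | y' , k' , e' , us = _ , k , refl , up-step y' k' e' (isNode ndy) us (φ→A (isNode ndy) f)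

    up⇒unfold : ∀ {y} → Node y → UpSince A B y → ∀ {s k} → s ≡ y ++ [ k ] → Node s → Unfold (R D⇑ T) Φ Ψ s
    up⇒unfold ndy (up-here b) {k = k} refl nd = now (unNode ndy , unNode nd , k , refl) (B→ψ ndy b)
    up⇒unfold ndy (up-step r k' e _ us a) {k = k} refl nd =
      later (unNode ndy , unNode nd , k , refl) (A→φ ndy a) (up⇒unfold (prefix r [ k' ] (subst Node e ndy)) us e ndy)

    -- The first step comes from a first child (⊖) or from a later one (χ_P).
    correct⇑ : Agrees (until D⇑ φ ψ)
    correct⇑ {s} nd =
      mk⇔ (λ x → to-word (unfold⇒up (Equivalence.to (until⇔unfold D⇑) x)))
          (λ y → let (y' , k , e , us) = from-word y
                 in Equivalence.from (until⇔unfold D⇑) (up⇒unfold (prefix y' [ k ] (subst Node e nd)) us e nd))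
      where
      to-word : ParentUpSince s → Sat (ι (until D⇑ φ ψ)) (pos s)
      to-word (y , zero , refl , us) =
        inj₁ (parent-of-first-⊖ {X = Sχ Π⋖≐ A B} nd (child-prec-⋖≐ nd) (UpSince⇒Sχ (prefix y [ 0 ] nd) us))
      to-word (y , suc k , refl , us) =
        inj₂ (parent-of-later-χP {X = Sχ Π⋖≐ A B} nd (child-prec-⋖≐ nd) (UpSince⇒Sχ (prefix y [ suc k ] nd) us))
      from-word : Sat (ι (until D⇑ φ ψ)) (pos s) → ParentUpSince s
      from-word (inj₁ x) with ⊖-parent-of-first {X = Sχ Π⋖≐ A B} nd ⋖≐-below x
      ... | r , refl , _ , u = r , 0 , refl , Sχ⇒UpSince (prefix r [ 0 ] nd) u
      from-word (inj₂ x) with χP-parent-of-later {X = Sχ Π⋖≐ A B} nd ⋖≐-below x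
      ... | r , k , refl , _ , u = r , suc k , refl , Sχ⇒UpSince (prefix r [ suc k ] nd) u

    -- ⇒(φ,ψ) at r·h: ψ at a later sibling r·t and φ strictly between (RightWitness).
    -- The four disjuncts of ι⇒ cover h = 0 or h > 0, and r ⋖ r·t or r ≐ r·t.
    ι⇒ : POTL n
    ι⇒ = ι (until D⇒ φ ψ)

    Between : List ℕ → ℕ → ℕ → Set
    Between r a b = ∀ j → a < j → j < b → Φ (r ++ [ j ])

    between→A : ∀ {r a b} → Node (r ++ [ b ]) → Between r a b → ∀ j → a < j → j < b → Sat A (pos (r ++ [ j ]))
    between→A nd fs j p q = φ→A (earlier-sibling nd (<⇒≤ q)) (fs j p q)

    -- h > 0 and r ⋖ r·t: the siblings from r·h to r·t form a U_H^⋖ path.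
    right-yield : ∀ {r h t} → Node (r ++ [ t ]) → 0 < h → h < t → PosPrec r ⋖ (r ++ [ t ]) → Ψ (r ++ [ t ]) →
                  Between r h t → Sat ι⇒ (pos (r ++ [ h ]))
    right-yield ndt 0<h h<t yields p fs = inj₁ (run-to-○HUH {A = A} {B = B} ndt 0<h h<t yields (ψ→B ndt p) (between→A ndt fs))

    -- h > 0 and r ≐ r·t: r·t is the last child, reached from the parent by χ_F^≐,
    -- and no ⋖-sibling after r·h violates φ.
    right-equal : ∀ {r h t} → Node (r ++ [ h ]) → Node (r ++ [ t ]) → 0 < h → h < t → PosPrec r ≐ (r ++ [ t ]) →
                  Ψ (r ++ [ t ]) → Between r h t → Sat ι⇒ (pos (r ++ [ h ]))
    right-equal {r} {suc h} {suc t} nd ndt _ h<t eq-prec p fs =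
      inj₂ (inj₁ (no-violation , parent-of-later-χP {X = χF Π≐ B} nd (in-Π⋖ (non-last-⋖ ndt h<t))
                                   (later-child-χF {X = B} ndt (in-Π≐ eq-prec) (ψ→B ndt p))))
      where
      no-violation : ¬ Sat ViolationAfter (pos (r ++ [ suc h ]))
      no-violation y with ○HUH-to-run {A = ⊤ₚ} {B = ¬ₚ A} nd y
      ... | j , h<j , ndj , yields , ¬a , _ = ¬a (φ→A ndj (fs j h<j (before-≐-child ndj ndt eq-prec yields)))

    -- h = 0 and r ⋖ r·t: from the parent by χ_F^⋖, with no earlier sibling violating φ.
    right-first-yield : ∀ {r t} → Node (r ++ [ 0 ]) → Node (r ++ [ t ]) → 0 < t → PosPrec r ⋖ (r ++ [ t ]) →
                        Ψ (r ++ [ t ]) → Between r 0 t → Sat ι⇒ (pos (r ++ [ 0 ]))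
    right-first-yield {r} {suc t} nd ndt _ yields p fs =
      inj₂ (inj₂ (inj₁ (parent-of-first-⊖ {X = χF Π⋖ (B ∧ₚ ¬ₚ ViolationBefore)} nd
                          (in-Π⋖ (non-last-⋖ ndt (s≤s z≤n)))
                          (later-child-χF {X = B ∧ₚ ¬ₚ ViolationBefore} ndt (in-Π⋖ yields) (ψ→B ndt p , no-violation)))))
      where
      no-violation : ¬ Sat ViolationBefore (pos (r ++ [ suc t ]))
      no-violation y with ⊖HSH-to-run {A = ⊤ₚ} {B = ¬ₚ A} ndt y
      ... | j , 0<j , j<t , ndj , ¬a , _ = ¬a (φ→A ndj (fs j 0<j j<t))

    -- h = 0 and r ≐ r·t: from the parent by χ_F^≐, with no ⋖-child violating φ.
    right-first-equal : ∀ {r t} → Node (r ++ [ 0 ]) → Node (r ++ [ t ]) → 0 < t → PosPrec r ≐ (r ++ [ t ]) →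
                        Ψ (r ++ [ t ]) → Between r 0 t → Sat ι⇒ (pos (r ++ [ 0 ]))
    right-first-equal {r} {suc t} nd ndt _ eq-prec p fs =
      inj₂ (inj₂ (inj₂ (parent-of-first-⊖ {X = χF Π≐ B ∧ₚ ¬ₚ ViolationBelow} nd
                          (in-Π⋖ (non-last-⋖ ndt (s≤s z≤n)))
                          (later-child-χF {X = B} ndt (in-Π≐ eq-prec) (ψ→B ndt p) , no-violation))))
      where
      no-violation : ¬ Sat ViolationBelow (pos r)
      no-violation y with χF-later-child {X = ¬ₚ A} (prefix r [ 0 ] nd) ⋖-below y
      ... | k , ndk , yields , ¬a = ¬a (φ→A ndk (fs (suc k) (s≤s z≤n) (before-≐-child ndk ndt eq-prec (only-⋖ yields))))

    witness⇒ι⇒ : ∀ {r h} → Node (r ++ [ h ]) → RightWitness Φ Ψ r h → Sat ι⇒ (pos (r ++ [ h ]))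
    witness⇒ι⇒ {h = zero}  nd (t , 0<t , ndt , p , fs) with child-⋖≐ ndt
    ... | inj₁ yields = right-first-yield nd ndt 0<t yields p fs
    ... | inj₂ eq-prec = right-first-equal nd ndt 0<t eq-prec p fs
    witness⇒ι⇒ {h = suc h} nd (t , h<t , ndt , p , fs) with child-⋖≐ ndt
    ... | inj₁ yields = right-yield ndt (s≤s z≤n) h<t yields p fs
    ... | inj₂ eq-prec = right-equal nd ndt (s≤s z≤n) h<t eq-prec p fs

    -- Conversely, each disjunct yields a witness; the negated parts give φ in between.
    ι⇒⇒witness : ∀ {r h} → Node (r ++ [ h ]) → Sat ι⇒ (pos (r ++ [ h ])) → RightWitness Φ Ψ r h
    ι⇒⇒witness nd (inj₁ x) with ○HUH-to-run {A = A} {B = B} nd x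
    ... | t , h<t , ndt , _ , b , as = t , h<t , ndt , B→ψ ndt b , λ j p q → A→φ (earlier-sibling ndt (<⇒≤ q)) (as j p q)
    ι⇒⇒witness {r} nd (inj₂ (inj₁ (no-violation , y))) with χP-parent-of-later {X = χF Π≐ B} nd ⋖-below y
    ... | r' , k , e , yields , z with snoc-injective e
    ...   | refl , refl with χF-later-child {X = B} (prefix r [ suc k ] nd) ≐-below z
    ...     | t , ndt , eq-prec , b = suc t , h<t , ndt , B→ψ ndt b , between
      where
      h<t = before-≐-child nd ndt (only-≐ eq-prec) (only-⋖ yields)
      between : Between r (suc k) (suc t)
      between j p q = φ-unless ndj λ ¬a →
        no-violation (run-to-○HUH {A = ⊤ₚ} {B = ¬ₚ A} ndj (s≤s z≤n) p (non-last-⋖ ndt q) ¬a (λ _ _ _ → tt))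
        where ndj = earlier-sibling ndt (<⇒≤ q)
    ι⇒⇒witness {r} nd (inj₂ (inj₂ (inj₁ x)))
      with ⊖-parent-of-first {X = χF Π⋖ (B ∧ₚ ¬ₚ ViolationBefore)} nd ⋖-below x
    ... | r' , e , _ , y with snoc-injective e
    ...   | refl , refl with χF-later-child {X = B ∧ₚ ¬ₚ ViolationBefore} (prefix r [ 0 ] nd) ⋖-below y
    ...     | t , ndt , yields , (b , no-violation) = suc t , s≤s z≤n , ndt , B→ψ ndt b , between
      where
      between : Between r 0 (suc t)
      between j p q = φ-unless ndj λ ¬a →
        no-violation (run-to-⊖HSH {A = ⊤ₚ} {B = ¬ₚ A} ndt (only-⋖ yields) p q ¬a (λ _ _ _ → tt))
        where ndj = earlier-sibling ndt (<⇒≤ q)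
    ι⇒⇒witness {r} nd (inj₂ (inj₂ (inj₂ x)))
      with ⊖-parent-of-first {X = χF Π≐ B ∧ₚ ¬ₚ ViolationBelow} nd ⋖-below x
    ... | r' , e , _ , (y , no-violation) with snoc-injective e
    ...   | refl , refl with χF-later-child {X = B} (prefix r [ 0 ] nd) ≐-below y
    ...     | t , ndt , eq-prec , b = suc t , s≤s z≤n , ndt , B→ψ ndt b , between
      where
      between : Between r 0 (suc t)
      between (suc j) _ q = φ-unless ndj λ ¬a → no-violation (later-child-χF {X = ¬ₚ A} ndj (in-Π⋖ (non-last-⋖ ndt q)) ¬a)
        where ndj = earlier-sibling ndt (<⇒≤ q)

    -- No disjunct of ι⇒ holds at the root, which has neither parent nor siblings.
    ι⇒-not-at-root : ¬ Sat ι⇒ (pos [])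
    ι⇒-not-at-root (inj₁ (_ , () , _))
    ι⇒-not-at-root (inj₂ (inj₁ (_ , (_ , () , _))))
    ι⇒-not-at-root (inj₂ (inj₂ (inj₁ (_ , () , _))))
    ι⇒-not-at-root (inj₂ (inj₂ (inj₂ (_ , () , _))))

    correct⇒ : Agrees (until D⇒ φ ψ)
    correct⇒ {s} nd with initLast s
    ... | []      = mk⇔ (⊥-elim ∘ right-at-root) (⊥-elim ∘ ι⇒-not-at-root)
    ... | r ∷ʳ′ h = mk⇔ (witness⇒ι⇒ nd ∘ Equivalence.to (right⇔witness nd))
                        (Equivalence.from (right⇔witness nd) ∘ ι⇒⇒witness nd)

    -- ⇐(φ,ψ) at r·h, the mirror image: let r·t (t < h) be the ψ-sibling.
    ι⇐ : POTL n
    ι⇐ = ι (until D⇐ φ ψ)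

    -- r ⋖ r·h and t > 0: the siblings from r·t to r·(h-1) form an S_H^⋖ path.
    left-yield : ∀ {r h t} → Node (r ++ [ h ]) → PosPrec r ⋖ (r ++ [ h ]) → 0 < t → t < h → Ψ (r ++ [ t ]) →
                 Between r t h → Sat ι⇐ (pos (r ++ [ h ]))
    left-yield nd yields 0<t t<h p fs =
      inj₁ (run-to-⊖HSH {A = A} {B = B} nd yields 0<t t<h (ψ→B (earlier-sibling nd (<⇒≤ t<h)) p) (between→A nd fs))

    -- r ⋖ r·h and t = 0: the parent reaches r·0 by ○^⋖, and no earlier ⋖-sibling violates φ.
    left-yield-first : ∀ {r h} → Node (r ++ [ suc h ]) → PosPrec r ⋖ (r ++ [ suc h ]) → Ψ (r ++ [ 0 ]) →
                       Between r 0 (suc h) → Sat ι⇐ (pos (r ++ [ suc h ]))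
    left-yield-first {r} {h} nd yields p fs =
      inj₂ (inj₂ (inj₁ (parent-of-later-χP {X = ○ Π⋖ B} nd (in-Π⋖ yields)
                          (first-child-○ {X = B} nd0 (in-Π⋖ (non-last-⋖ nd (s≤s z≤n))) (ψ→B nd0 p)) ,
                        no-violation)))
      where
      nd0 = earlier-sibling nd z≤n
      no-violation : ¬ Sat ViolationBefore (pos (r ++ [ suc h ]))
      no-violation y with ⊖HSH-to-run {A = ⊤ₚ} {B = ¬ₚ A} nd y
      ... | j , 0<j , j<h , ndj , ¬a , _ = ¬a (φ→A ndj (fs j 0<j j<h))

    -- r ≐ r·h and t > 0: the parent reaches the previous sibling, which has no next
    -- ⋖-sibling, by χ_F^⋖, and the S_H^⋖ path ends there.
    left-equal : ∀ {r h t} → Node (r ++ [ h ]) → PosPrec r ≐ (r ++ [ h ]) → 0 < t → t < h → Ψ (r ++ [ t ]) →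
                 Between r t h → Sat ι⇐ (pos (r ++ [ h ]))
    left-equal {r} {suc (suc k)} nd eq-prec 0<t t<h p fs =
      inj₂ (inj₁ (parent-of-later-χP {X = χF Π⋖ ((¬ₚ ○H hY ⊤ₚ) ∧ₚ SH hY A B)} nd (in-Π≐ eq-prec)
                   (later-child-χF {X = (¬ₚ ○H hY ⊤ₚ) ∧ₚ SH hY A B} ndk (in-Π⋖ (non-last-⋖ nd ≤-refl))
                     (no-next , run-to-SH {A = A} {B = B} 0<t (≤-pred t<h) ndk (non-last-⋖ nd ≤-refl) b as))))
      where
      ndk = previous-sibling nd
      b   = ψ→B (earlier-sibling nd (<⇒≤ t<h)) p
      as  = λ j q₁ q₂ → between→A nd fs j q₁ (s≤s q₂)
      no-next : ¬ Sat (○H hY ⊤ₚ) (pos (r ++ [ suc k ]))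
      no-next y with ○H-next-sibling {X = ⊤ₚ} ndk y
      ... | r' , m , e , _ , _ , l₂ , _ with snoc-injective e
      ...   | refl , refl = ⋖-and-≐ l₂ eq-prec
    left-equal {h = suc zero} nd eq-prec (s≤s z≤n) (s≤s ()) p fs

    -- r ≐ r·h and t = 0: the parent reaches r·0 by ○^⋖, and no ⋖-child violates φ.
    left-equal-first : ∀ {r h} → Node (r ++ [ suc h ]) → PosPrec r ≐ (r ++ [ suc h ]) → Ψ (r ++ [ 0 ]) →
                       Between r 0 (suc h) → Sat ι⇐ (pos (r ++ [ suc h ]))
    left-equal-first {r} {h} nd eq-prec p fs =
      inj₂ (inj₂ (inj₂ (parent-of-later-χP {X = ○ Π⋖ B ∧ₚ ¬ₚ ViolationBelow} nd (in-Π≐ eq-prec)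
                          (first-child-○ {X = B} nd0 (in-Π⋖ (non-last-⋖ nd (s≤s z≤n))) (ψ→B nd0 p) , no-violation))))
      where
      nd0 = earlier-sibling nd z≤n
      no-violation : ¬ Sat ViolationBelow (pos r)
      no-violation y with χF-later-child {X = ¬ₚ A} (prefix r [ suc h ] nd) ⋖-below y
      ... | k , ndk , yields , ¬a = ¬a (φ→A ndk (fs (suc k) (s≤s z≤n) (before-≐-child ndk nd eq-prec (only-⋖ yields))))

    witness⇒ι⇐ : ∀ {r h} → Node (r ++ [ h ]) → LeftWitness Φ Ψ r h → Sat ι⇐ (pos (r ++ [ h ]))
    witness⇒ι⇐ {h = suc h} nd (t , t<h , p , fs) with child-⋖≐ nd | t
    ... | inj₁ yields  | zero  = left-yield-first nd yields p fs
    ... | inj₂ eq-prec | zero  = left-equal-first nd eq-prec p fs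
    ... | inj₁ yields  | suc _ = left-yield nd yields (s≤s z≤n) t<h p fs
    ... | inj₂ eq-prec | suc _ = left-equal nd eq-prec (s≤s z≤n) t<h p fs

    ι⇐⇒witness : ∀ {r h} → Node (r ++ [ h ]) → Sat ι⇐ (pos (r ++ [ h ])) → LeftWitness Φ Ψ r h
    ι⇐⇒witness nd (inj₁ x) with ⊖HSH-to-run {A = A} {B = B} nd x
    ... | t , _ , t<h , ndt , b , as = t , t<h , B→ψ ndt b , λ j p q → A→φ (earlier-sibling nd (<⇒≤ q)) (as j p q)
    ι⇐⇒witness {r} nd (inj₂ (inj₁ x))
      with χP-parent-of-later {X = χF Π⋖ ((¬ₚ ○H hY ⊤ₚ) ∧ₚ SH hY A B)} nd ≐-below x
    ... | r' , k , e , eq-prec , y with snoc-injective e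
    ...   | refl , refl with χF-later-child {X = (¬ₚ ○H hY ⊤ₚ) ∧ₚ SH hY A B} (prefix r [ suc k ] nd) ⋖-below y
    ...     | k₂ , ndk₂ , yields , (no-next , sh)
      with no-next-⋖-sibling nd (before-≐-child ndk₂ nd (only-≐ eq-prec) (only-⋖ yields)) no-next
    ...       | refl with SH-to-run {A = A} {B = B} ndk₂ sh
    ...         | t , _ , t≤k , ndt , b , as =
      t , s≤s t≤k , B→ψ ndt b , λ j p q → A→φ (earlier-sibling nd (<⇒≤ q)) (as j p (≤-pred q))
    ι⇐⇒witness {r} nd (inj₂ (inj₂ (inj₁ (x , no-violation)))) with χP-parent-of-later {X = ○ Π⋖ B} nd ⋖-below x
    ... | r' , k , e , yields , y with snoc-injective e
    ...   | refl , refl with ○-first-child {X = B} (prefix r [ suc k ] nd) ⋖-below y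
    ...     | nd0 , _ , b = 0 , s≤s z≤n , B→ψ nd0 b , between
      where
      between : Between r 0 (suc k)
      between j p q = φ-unless (earlier-sibling nd (<⇒≤ q)) λ ¬a →
        no-violation (run-to-⊖HSH {A = ⊤ₚ} {B = ¬ₚ A} nd (only-⋖ yields) p q ¬a (λ _ _ _ → tt))
    ι⇐⇒witness {r} nd (inj₂ (inj₂ (inj₂ x)))
      with χP-parent-of-later {X = ○ Π⋖ B ∧ₚ ¬ₚ ViolationBelow} nd ≐-below x
    ... | r' , k , e , _ , (y , no-violation) with snoc-injective e
    ...   | refl , refl with ○-first-child {X = B} (prefix r [ suc k ] nd) ⋖-below y
    ...     | nd0 , _ , b = 0 , s≤s z≤n , B→ψ nd0 b , between
      where
      between : Between r 0 (suc k)
      between (suc j) _ q = φ-unless ndj λ ¬a → no-violation (later-child-χF {X = ¬ₚ A} ndj (in-Π⋖ (non-last-⋖ nd q)) ¬a)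
        where ndj = earlier-sibling nd (<⇒≤ q)

    ι⇐-not-at-root : ¬ Sat ι⇐ (pos [])
    ι⇐-not-at-root (inj₁ (_ , () , _))
    ι⇐-not-at-root (inj₂ (inj₁ (_ , () , _)))
    ι⇐-not-at-root (inj₂ (inj₂ (inj₁ ((_ , () , _) , _))))
    ι⇐-not-at-root (inj₂ (inj₂ (inj₂ (_ , () , _))))

    correct⇐ : Agrees (until D⇐ φ ψ)
    correct⇐ {s} nd with initLast s
    ... | []      = mk⇔ (⊥-elim ∘ left-at-root) (⊥-elim ∘ ι⇐-not-at-root)
    ... | r ∷ʳ′ h = mk⇔ (witness⇒ι⇐ nd ∘ Equivalence.to (left⇔witness nd))
                        (Equivalence.from (left⇔witness nd) ∘ ι⇐⇒witness nd)

  correct : ∀ φ → Agrees φ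
  correct (prop p)      nd = mk⇔ (subst (p ∈L_) (sym (label-at-pos nd))) (subst (p ∈L_) (label-at-pos nd))
  correct ⊤ₓ            nd = mk⇔ (λ _ → tt) (λ _ → tt)
  correct (¬ₓ φ)        nd = mk⇔ (λ ¬x y → ¬x (Equivalence.from (correct φ nd) y))
                                 (λ ¬y x → ¬y (Equivalence.to (correct φ nd) x))
  correct (φ ∧ₓ ψ)      nd = mk⇔ (Data.Product.map (Equivalence.to (correct φ nd)) (Equivalence.to (correct ψ nd)))
                                 (Data.Product.map (Equivalence.from (correct φ nd)) (Equivalence.from (correct ψ nd)))
  correct (until ρ φ ψ) nd = by-direction ρ nd
    where
    open UntilCases φ ψ (correct φ) (correct ψ)
    by-direction : ∀ ρ → Agrees (until ρ φ ψ)
    by-direction D⇓ = correct⇓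
    by-direction D⇑ = correct⇑
    by-direction D⇒ = correct⇒
    by-direction D⇐ = correct⇐

lemma2 : ∀ {n : ℕ} (isS : Fin n → Bool) (M : OPM n isS) (φ : XU n) (T : Tree n) →
         InTM M T → (s : List ℕ) → IsNode T s →
         XSat T φ s ⇔ WordSem.Sat M (wordOf T) (ι φ) (τ⁻¹ T s)
lemma2 isS M φ T tm s nd = Translation.correct M T tm φ (NodePositions.isNode nd)
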